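{- Let $\alpha$ be an ordinal and let $(A,B),(C,D)\in\overline{\mathbb{R}}_\alpha$ be proper Dedekind cuts. Then their sum $(A+C,B+D)$ is a proper Dedekind cut.
   Context: For an ordinal $\alpha$, let $\mathbb{N}_\alpha$ be the set of ordinals strictly less than $\omega^{\omega^\alpha}$ with the ordinal order and the natural (Hessenberg) sum and product. Let $\mathbb{Z}_\alpha$ be the classes of pairs $(a,b)\in\mathbb{N}_\alpha^2$ under $(a,b)\sim(c,d)\iff a+d=b+c$, with $(a,b)+(c,d)=(a+c,b+d)$, $(a,b)(c,d)=(ac+bd,ad+bc)$, order $[(a_1,a_2)]\ge[(b_1,b_2)]\iff a_1+b_2\ge a_2+b_1$. Let $\mathbb{Q}_\alpha$ be its field of fractions (classes of $(a,b)$, $b\ne0$, under $ad=bc$, usual fraction operations), a linearly ordered field with $A\ge0$ iff $ab\ge0$ for representatives and $A\ge B$ iff $A-B\ge0$; $\mathbb{Q}_\alpha^+$ denotes its positive elements. A Dedekind cut on $\mathbb{Q}_\alpha$ is a pair $(A,B)$ of subsets such that: every element of $A$ is less than every element of $B$; $\mathbb{Q}_\alpha\setminus(A\cup B)$ has at most one element; $\inf(B)\notin B$ and $\sup(A)\notin A$; $A\cap B=\varnothing$. $\overline{\mathbb{R}}_\alpha$ is the set of all Dedekind cuts on $\mathbb{Q}_\alpha$. A ball in $\mathbb{Q}_\alpha$ is a set $\{y\in\mathbb{Q}_\alpha: |x-y|<r\}$, $x\in\mathbb{Q}_\alpha$, $r\in\mathbb{Q}_\alpha^+$. A cut $(A,B)$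 is improper if there exists $d\in\mathbb{Q}_\alpha^+$ such that every ball $U$ meeting both $A$ and $B$ satisfies $\sup(U)-\inf(U)>d$; otherwise it is proper. The sum of cuts is $(A,B)+(C,D)=(A+C,B+D)$, where $X+Y=\{x+y: x\in X, y\in Y\}$. -}

module Defs where

open import Data.List using (List; []; _∷_; _++_; map; concatMap; [_])
open import Data.Product using (_×_; _,_; Σ; ∃; proj₁; proj₂)
open import Data.Bool using (Bool; true; false; if_then_else_)
open import Relation.Binary.PropositionalEquality using (_≡_)
open import Relation.Binary.Core using (Rel)
open import Relation.Binary.Definitions using (tri<; tri≈; tri>)
open import Relation.Binary.Structures using (IsStrictTotalOrder)
open import Induction.WellFounded using (WellFounded)
open import Relation.Nullary using (¬_)
open import Data.Empty using (⊥)

-- An ordinal α is represented by (the order type of) a well-ordered set: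
-- a set with a strict total order that is well-founded.  The elements of
-- the carrier play the role of the ordinals β < α.
record Ordinal : Set₁ where
  field
    Carrier : Set
    _<_     : Rel Carrier _
    isSTO   : IsStrictTotalOrder _≡_ _<_
    wf      : WellFounded _<_

data Cmp : Set where
  lt eq gt : Cmp

module Ops (α : Ordinal) where
  open Ordinal α renaming (Carrier to O)
  open IsStrictTotalOrder isSTO using (compare)

  -- Exponents: ordinals < ω^α, i.e. ω^β₁ ⊕ … ⊕ ω^βₖ with βᵢ < α,
  -- represented by the (unordered) list [β₁,…,βₖ]; natural sum = _++_.
  E : Set
  E = List O

  insertO : O → List O → List O
  insertO x [] = x ∷ []
  insertO x (y ∷ ys) with compare x y
  ... | tri< _ _ _ = y ∷ insertO x ys
  ... | tri≈ _ _ _ = x ∷ y ∷ ys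
  ... | tri> _ _ _ = x ∷ y ∷ ys

  -- sort into non-increasing order (Cantor normal form)
  sortO : List O → List O
  sortO [] = []
  sortO (x ∷ xs) = insertO x (sortO xs)

  lexO : List O → List O → Cmp
  lexO [] [] = eq
  lexO [] (_ ∷ _) = lt
  lexO (_ ∷ _) [] = gt
  lexO (x ∷ xs) (y ∷ ys) with compare x y
  ... | tri< _ _ _ = lt
  ... | tri≈ _ _ _ = lexO xs ys
  ... | tri> _ _ _ = gt

  cmpE : E → E → Cmp
  cmpE e f = lexO (sortO e) (sortO f)

  -- ℕ_α : ordinals < ω^(ω^α), i.e. ω^e₁ ⊕ … ⊕ ω^eₘ with eᵢ < ω^α,
  -- represented by the list [e₁,…,eₘ].
  N : Set
  N = List E

  insertE : E → List E → List E
  insertE x [] = x ∷ []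
  insertE x (y ∷ ys) with cmpE x y
  ... | lt = y ∷ insertE x ys
  ... | eq = x ∷ y ∷ ys
  ... | gt = x ∷ y ∷ ys

  sortE : List E → List E
  sortE [] = []
  sortE (x ∷ xs) = insertE x (sortE xs)

  lexE : List E → List E → Cmp
  lexE [] [] = eq
  lexE [] (_ ∷ _) = lt
  lexE (_ ∷ _) [] = gt
  lexE (x ∷ xs) (y ∷ ys) with cmpE x y
  ... | lt = lt
  ... | eq = lexE xs ys
  ... | gt = gt

  cmpN : N → N → Cmp
  cmpN a b = lexE (sortE a) (sortE b)

  _≈N_ : N → N → Set
  a ≈N b = cmpN a b ≡ eq

  _≤N_ : N → N → Set
  a ≤N b = ¬ (cmpN a b ≡ gt)

  leNb : N → N → Bool
  leNb a b with cmpN a b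
  ... | gt = false
  ... | _  = true

  _+N_ : N → N → N
  a +N b = a ++ b

  _*N_ : N → N → N
  a *N b = concatMap (λ e → map (λ f → e ++ f) b) a

  0N : N
  0N = []

  Z : Set
  Z = N × N

  _≈Z_ : Z → Z → Set
  (a , b) ≈Z (c , d) = (a +N d) ≈N (b +N c)

  _+Z_ : Z → Z → Z
  (a , b) +Z (c , d) = (a +N c , b +N d)

  _*Z_ : Z → Z → Z
  (a , b) *Z (c , d) = ((a *N c) +N (b *N d) , (a *N d) +N (b *N c))

  -Z_ : Z → Z
  -Z (a , b) = (b , a)

  0Z : Z
  0Z = (0N , 0N)

  _≥Z_ : Z → Z → Set
  (a₁ , a₂) ≥Z (b₁ , b₂) = (a₂ +N b₁) ≤N (a₁ +N b₂)

  geZb : Z → Z → Bool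
  geZb (a₁ , a₂) (b₁ , b₂) = leNb (a₂ +N b₁) (a₁ +N b₂)

  -- ℚ_α : raw fractions (a,b); only those with b ≠ 0 are elements (Valid).
  Q : Set
  Q = Z × Z

  Valid : Q → Set
  Valid (a , b) = ¬ (b ≈Z 0Z)

  _≈Q_ : Q → Q → Set
  (a , b) ≈Q (c , d) = (a *Z d) ≈Z (b *Z c)

  _+Q_ : Q → Q → Q
  (a , b) +Q (c , d) = ((a *Z d) +Z (c *Z b) , b *Z d)

  -Q_ : Q → Q
  -Q (a , b) = (-Z a , b)

  _-Q_ : Q → Q → Q
  x -Q y = x +Q (-Q y)

  NonNeg : Q → Set
  NonNeg (a , b) = (a *Z b) ≥Z 0Z

  nonNegb : Q → Bool
  nonNegb (a , b) = geZb (a *Z b) 0Z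

  _≤Q_ : Q → Q → Set
  x ≤Q y = NonNeg (y -Q x)

  _<Q_ : Q → Q → Set
  x <Q y = (x ≤Q y) × ¬ (x ≈Q y)

  absQ : Q → Q
  absQ x = if nonNegb x then x else (-Q x)

  1N : N
  1N = [] ∷ []

  0Q : Q
  0Q = (0Z , (1N , 0N))

  Positive : Q → Set
  Positive x = Valid x × (0Q <Q x)

  SubQ : Set₁
  SubQ = Q → Set

  IsUpperBound : SubQ → Q → Set
  IsUpperBound S s = ∀ x → Valid x → S x → x ≤Q s

  IsLowerBound : SubQ → Q → Set
  IsLowerBound S s = ∀ x → Valid x → S x → s ≤Q x

  IsSup : SubQ → Q → Set
  IsSup S s = Valid s × IsUpperBound S s
            × (∀ u → Valid u → IsUpperBound S u → s ≤Q u)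

  IsInf : SubQ → Q → Set
  IsInf S s = Valid s × IsLowerBound S s
            × (∀ u → Valid u → IsLowerBound S u → u ≤Q s)

  IsSubset : SubQ → Set
  IsSubset S = (∀ x → S x → Valid x)
             × (∀ x y → Valid y → x ≈Q y → S x → S y)

  record IsCut (A B : SubQ) : Set where
    field
      subA       : IsSubset A
      subB       : IsSubset B
      A<B        : ∀ a b → A a → B b → a <Q b
      gapAtMost1 : ∀ x y → Valid x → Valid y
                   → ¬ A x → ¬ B x → ¬ A y → ¬ B y → x ≈Q y
      infB∉B     : ∀ s → IsInf B s → ¬ B s
      supA∉A     : ∀ s → IsSup A s → ¬ A s
      disjoint   : ∀ x → A x → B x → ⊥

  Ball : Q → Q → SubQ
  Ball x r y = Valid y × (absQ (x -Q y) <Q r)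

  Meets : SubQ → SubQ → Set
  Meets U S = ∃ λ y → U y × S y

  DiamGt : SubQ → Q → Set
  DiamGt U d = ∃ λ s → ∃ λ i → IsSup U s × IsInf U i × (d <Q (s -Q i))

  Improper : SubQ → SubQ → Set
  Improper A B = ∃ λ d → Positive d ×
    (∀ x r → Valid x → Positive r → Meets (Ball x r) A → Meets (Ball x r) B
       → DiamGt (Ball x r) d)

  Proper : SubQ → SubQ → Set
  Proper A B = ¬ Improper A B

  _⊕_ : SubQ → SubQ → SubQ
  (X ⊕ Y) z = Valid z × ∃ λ x → ∃ λ y → X x × Y y × (z ≈Q (x +Q y))

-- Properness of a cut means: for every δ > 0 there are, not-not, a ∈ A and
-- b ∈ B with b - a < δ.  Adding close pairs of the two cuts gives close pairs
-- of the sum, which yields both properness of the sum and that its gap has at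
-- most one point.  The latter also needs that A + C contains every z below some
-- a + k: among the decompositions z = (a - u) + (k - (t - u)), t = a + k - z,
-- at most one u fails for A and at most one for C, since each gap has at most
-- one point, so one of three values of u works.
--
-- Underneath, ℚα is the fraction field of ℤα, ordered by the sign of n d for
-- n / d.  Its order axioms reduce to: a₂ < a₁ and b₂ < b₁ imply
-- a₁ b₂ + a₂ b₁ < a₁ b₁ + a₂ b₂ for the natural sum and product on ℕα, proved
-- by comparing Cantor normal forms as multisets of exponents.

module Submission where

open import Defs
open import Data.Product using (_×_; _,_)

module Comparison where

  open import Defs using (Cmp; lt; eq; gt)
  open import Data.Empty using (⊥-elim)
  open import Data.Sum using (_⊎_; inj₁; inj₂)
  open import Level using (0ℓ)
  open import Relation.Binary.Bundles using (Setoid)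
  open import Relation.Binary.PropositionalEquality
  open import Relation.Nullary using (¬_)

  flipCmp : Cmp → Cmp
  flipCmp lt = gt
  flipCmp eq = eq
  flipCmp gt = lt

  _then_ : Cmp → Cmp → Cmp
  lt then _ = lt
  eq then c = c
  gt then _ = gt

  ≡lt⇒≢gt : ∀ {c} → c ≡ lt → c ≢ gt
  ≡lt⇒≢gt refl ()

  ≡eq⇒≢gt : ∀ {c} → c ≡ eq → c ≢ gt
  ≡eq⇒≢gt refl ()

  ≡eq⇒≢lt : ∀ {c} → c ≡ eq → c ≢ lt
  ≡eq⇒≢lt refl ()

  ≡gt⇒≢lt : ∀ {c} → c ≡ gt → c ≢ lt
  ≡gt⇒≢lt refl ()

  ≢gt⇒then-lt : ∀ c → c ≢ gt → c then lt ≡ lt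
  ≢gt⇒then-lt lt _ = refl
  ≢gt⇒then-lt eq _ = refl
  ≢gt⇒then-lt gt h = ⊥-elim (h refl)

  then-≢gt : ∀ c d → c ≢ gt → d ≢ gt → c then d ≢ gt
  then-≢gt lt d _ _ ()
  then-≢gt eq d _ h = h
  then-≢gt gt d h _ = ⊥-elim (h refl)

  ¬≢gt⇒≡gt : ∀ {c} → ¬ c ≢ gt → c ≡ gt
  ¬≢gt⇒≡gt {lt} h = ⊥-elim (h λ ())
  ¬≢gt⇒≡gt {eq} h = ⊥-elim (h λ ())
  ¬≢gt⇒≡gt {gt} h = refl

  record IsComparison {X : Set} (cmp : X → X → Cmp) : Set where
    field
      flip-cmp  : ∀ x y → cmp y x ≡ flipCmp (cmp x y)
      cmp-refl  : ∀ x → cmp x x ≡ eq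
      cmp-trans : ∀ x y z → cmp x y ≢ gt → cmp y z ≢ gt → cmp x z ≡ cmp x y then cmp y z

    infix 4 _≈_ _<_ _≤_

    _≈_ _<_ _≤_ : X → X → Set
    x ≈ y = cmp x y ≡ eq
    x < y = cmp x y ≡ lt
    x ≤ y = cmp x y ≢ gt

    flip-≡ : ∀ {x y c} → cmp x y ≡ c → cmp y x ≡ flipCmp c
    flip-≡ {x} {y} e = trans (flip-cmp x y) (cong flipCmp e)

    ≈-sym : ∀ {x y} → x ≈ y → y ≈ x
    ≈-sym = flip-≡

    <⇒> : ∀ {x y} → x < y → cmp y x ≡ gt
    <⇒> = flip-≡

    >⇒< : ∀ {x y} → cmp x y ≡ gt → y < x
    >⇒< = flip-≡

    ≮⇒≥ : ∀ {x y} → cmp x y ≢ lt → y ≤ x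
    ≮⇒≥ {x} {y} h q = h (trans (flip-cmp y x) (cong flipCmp q))

    <-≤-trans : ∀ {x y z} → x < y → y ≤ z → x < z
    <-≤-trans {x} {y} {z} e h =
      trans (cmp-trans x y z (≡lt⇒≢gt e) h) (cong (_then cmp y z) e)

    ≤-<-trans : ∀ {x y z} → x ≤ y → y < z → x < z
    ≤-<-trans {x} {y} {z} h e =
      trans (cmp-trans x y z h (≡lt⇒≢gt e)) (trans (cong (cmp x y then_) e) (≢gt⇒then-lt _ h))

    <-trans : ∀ {x y z} → x < y → y < z → x < z
    <-trans e f = <-≤-trans e (≡lt⇒≢gt f)

    ≤-trans : ∀ {x y z} → x ≤ y → y ≤ z → x ≤ z
    ≤-trans {x} {y} {z} h₁ h₂ = subst (_≢ gt) (sym (cmp-trans x y z h₁ h₂)) (then-≢gt _ _ h₁ h₂)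

    ≈-trans : ∀ {x y z} → x ≈ y → y ≈ z → x ≈ z
    ≈-trans {x} {y} {z} e₁ e₂ =
      trans (cmp-trans x y z (≡eq⇒≢gt e₁) (≡eq⇒≢gt e₂)) (trans (cong (_then cmp y z) e₁) e₂)

    ≈-respˡ : ∀ {x x′} z → x ≈ x′ → cmp x z ≡ cmp x′ z
    ≈-respˡ {x} {x′} z e with cmp x′ z in e₂
    ... | lt = trans (cmp-trans x x′ z (≡eq⇒≢gt e) (≡lt⇒≢gt e₂)) (trans (cong (_then cmp x′ z) e) e₂)
    ... | eq = trans (cmp-trans x x′ z (≡eq⇒≢gt e) (≡eq⇒≢gt e₂)) (trans (cong (_then cmp x′ z) e) e₂)
    ... | gt = trans (flip-cmp z x) (cong flipCmp (<-≤-trans (>⇒< e₂) (≡eq⇒≢gt (≈-sym e))))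

    ≈-respʳ : ∀ z {x x′} → x ≈ x′ → cmp z x ≡ cmp z x′
    ≈-respʳ z {x} {x′} e =
      trans (flip-cmp x z) (trans (cong flipCmp (≈-respˡ z e)) (sym (flip-cmp x′ z)))

    <-irrefl : ∀ {x} → ¬ x < x
    <-irrefl {x} x<x with () ← trans (sym x<x) (cmp-refl x)

    ≤⊎> : ∀ x y → x ≤ y ⊎ y < x
    ≤⊎> x y with cmp x y in e
    ... | lt = inj₁ λ ()
    ... | eq = inj₁ λ ()
    ... | gt = inj₂ (>⇒< e)

    <⊎≈⊎> : ∀ x y → x < y ⊎ x ≈ y ⊎ y < x
    <⊎≈⊎> x y with cmp x y in e
    ... | lt = inj₁ refl
    ... | eq = inj₂ (inj₁ refl)
    ... | gt = inj₂ (inj₂ (>⇒< e))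

    ≈-setoid : Setoid 0ℓ 0ℓ
    ≈-setoid = record
      { Carrier = X ; _≈_ = _≈_
      ; isEquivalence = record { refl = cmp-refl _ ; sym = ≈-sym ; trans = ≈-trans } }

  IsComparison-≗ : ∀ {X : Set} {f g : X → X → Cmp} → (∀ x y → f x y ≡ g x y) →
                   IsComparison g → IsComparison f
  IsComparison-≗ {f = f} {g} f≗g L = record
    { flip-cmp  = λ x y → trans (f≗g y x) (trans (flip-cmp x y) (cong flipCmp (sym (f≗g x y))))
    ; cmp-refl  = λ x → trans (f≗g x x) (cmp-refl x)
    ; cmp-trans = λ x y z h₁ h₂ →
        trans (f≗g x z) (trans (cmp-trans x y z (λ q → h₁ (trans (f≗g x y) q)) (λ q → h₂ (trans (f≗g y z) q)))
                               (sym (cong₂ _then_ (f≗g x y) (f≗g y z))))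
    }
    where open IsComparison L

open Comparison

module Multiset {X : Set} {cmp : X → X → Cmp} (L : IsComparison cmp) where

  open import Data.Empty using (⊥-elim)
  open import Function using (case_of_)
  open import Data.List using (List; []; _∷_; _++_)
  open import Data.List.Relation.Binary.Pointwise using (Pointwise; []; _∷_)
  open import Data.List.Relation.Unary.All using (All; []; _∷_)
  import Data.List.Relation.Unary.All as All
  open import Data.Product using (Σ; _×_; _,_)
  open import Data.Unit using (⊤; tt)
  open import Relation.Binary.PropositionalEquality

  open IsComparison L

  open import Data.List.Relation.Binary.Permutation.Setoid ≈-setoid public
    using (_↭_; ↭-refl; ↭-sym; ↭-trans; ↭-reflexive; ↭-isEquivalence; prep; swap)
    renaming (refl to ↭-pointwise)
  import Data.List.Relation.Binary.Permutation.Setoid ≈-setoid as ↭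
  open import Data.List.Relation.Binary.Permutation.Setoid.Properties ≈-setoid public
    using (++⁺; ++-comm; shifts; ++-isCommutativeMonoid)

  ins : X → List X → List X
  ins x [] = x ∷ []
  ins x (y ∷ ys) with cmp x y
  ... | lt = y ∷ ins x ys
  ... | eq = x ∷ y ∷ ys
  ... | gt = x ∷ y ∷ ys

  sort : List X → List X
  sort [] = []
  sort (x ∷ xs) = ins x (sort xs)

  lex : List X → List X → Cmp
  lex [] [] = eq
  lex [] (_ ∷ _) = lt
  lex (_ ∷ _) [] = gt
  lex (x ∷ xs) (y ∷ ys) with cmp x y
  ... | lt = lt
  ... | eq = lex xs ys
  ... | gt = gt

  cmpMS : List X → List X → Cmp
  cmpMS l m = lex (sort l) (sort m)

  ins-< : ∀ {x y ys} → x < y → ins x (y ∷ ys) ≡ y ∷ ins x ys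
  ins-< {x} {y} e with cmp x y
  ins-< refl | lt = refl

  ins-≮ : ∀ {x y ys} → cmp x y ≢ lt → ins x (y ∷ ys) ≡ x ∷ y ∷ ys
  ins-≮ {x} {y} h with cmp x y
  ... | lt = ⊥-elim (h refl)
  ... | eq = refl
  ... | gt = refl

  lex-∷-lt : ∀ {x y xs ys} → x < y → lex (x ∷ xs) (y ∷ ys) ≡ lt
  lex-∷-lt {x} {y} e with cmp x y
  lex-∷-lt refl | lt = refl

  lex-∷-eq : ∀ {x y xs ys} → x ≈ y → lex (x ∷ xs) (y ∷ ys) ≡ lex xs ys
  lex-∷-eq {x} {y} e with cmp x y
  lex-∷-eq refl | eq = refl

  lex-∷-gt : ∀ {x y xs ys} → cmp x y ≡ gt → lex (x ∷ xs) (y ∷ ys) ≡ gt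
  lex-∷-gt {x} {y} e with cmp x y
  lex-∷-gt refl | gt = refl

  lex-flip : ∀ l m → lex m l ≡ flipCmp (lex l m)
  lex-flip [] [] = refl
  lex-flip [] (_ ∷ _) = refl
  lex-flip (_ ∷ _) [] = refl
  lex-flip (x ∷ l) (y ∷ m) with cmp x y | cmp y x | flip-cmp x y
  ... | lt | .gt | refl = refl
  ... | eq | .eq | refl = lex-flip l m
  ... | gt | .lt | refl = refl

  lex-refl : ∀ l → lex l l ≡ eq
  lex-refl [] = refl
  lex-refl (x ∷ l) = trans (lex-∷-eq (cmp-refl x)) (lex-refl l)

  lex-trans : ∀ l m n → lex l m ≢ gt → lex m n ≢ gt → lex l n ≡ lex l m then lex m n
  lex-trans [] [] n _ _ = refl
  lex-trans [] (y ∷ m) [] _ q = ⊥-elim (q refl)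
  lex-trans [] (y ∷ m) (z ∷ n) _ _ = refl
  lex-trans (x ∷ l) [] n p _ = ⊥-elim (p refl)
  lex-trans (x ∷ l) (y ∷ m) [] _ q = ⊥-elim (q refl)
  lex-trans (x ∷ l) (y ∷ m) (z ∷ n) p q with cmp x y in e₁ | cmp y z in e₂
  ... | gt | _ = ⊥-elim (p refl)
  ... | lt | gt = ⊥-elim (q refl)
  ... | eq | gt = ⊥-elim (q refl)
  ... | lt | lt = lex-∷-lt (<-trans e₁ e₂)
  ... | lt | eq = lex-∷-lt (<-≤-trans e₁ (≡eq⇒≢gt e₂))
  ... | eq | lt = trans (lex-∷-lt (≤-<-trans (≡eq⇒≢gt e₁) e₂)) (sym (≢gt⇒then-lt _ p))
  ... | eq | eq = trans (lex-∷-eq (≈-trans e₁ e₂)) (lex-trans l m n p q)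

  lex-isComparison : IsComparison lex
  lex-isComparison = record { flip-cmp = lex-flip ; cmp-refl = lex-refl ; cmp-trans = lex-trans }

  private
    module Lex = IsComparison lex-isComparison

  lex-∷-cong : ∀ {y z a b a′ b′} → lex a b ≡ lex a′ b′ → lex (y ∷ a) (z ∷ b) ≡ lex (y ∷ a′) (z ∷ b′)
  lex-∷-cong {y} {z} h with cmp y z
  ... | lt = refl
  ... | eq = h
  ... | gt = refl

  lex-ins : ∀ x s t → lex (ins x s) (ins x t) ≡ lex s t
  lex-ins x [] [] = lex-∷-eq (cmp-refl x)
  lex-ins x [] (z ∷ t) with cmp x z in e
  ... | lt = lex-∷-lt e
  ... | eq = lex-∷-eq (cmp-refl x)
  ... | gt = lex-∷-eq (cmp-refl x)
  lex-ins x (y ∷ s) [] with cmp x y in e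
  ... | lt = lex-∷-gt (<⇒> e)
  ... | eq = lex-∷-eq (cmp-refl x)
  ... | gt = lex-∷-eq (cmp-refl x)
  lex-ins x (y ∷ s) (z ∷ t) with cmp x y in e₁ | cmp x z in e₂
  ... | lt | lt = lex-∷-cong (lex-ins x s t)
  ... | lt | eq = trans (lex-∷-gt (<⇒> e₁)) (sym (lex-∷-gt (<⇒> (≤-<-trans (≡eq⇒≢gt (≈-sym e₂)) e₁))))
  ... | lt | gt = trans (lex-∷-gt (<⇒> e₁)) (sym (lex-∷-gt (<⇒> (<-trans (>⇒< e₂) e₁))))
  ... | eq | lt = trans (lex-∷-lt e₂) (sym (lex-∷-lt (≤-<-trans (≡eq⇒≢gt (≈-sym e₁)) e₂)))
  ... | gt | lt = trans (lex-∷-lt e₂) (sym (lex-∷-lt (<-trans (>⇒< e₁) e₂)))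
  ... | eq | eq = lex-∷-eq (cmp-refl x)
  ... | eq | gt = lex-∷-eq (cmp-refl x)
  ... | gt | eq = lex-∷-eq (cmp-refl x)
  ... | gt | gt = lex-∷-eq (cmp-refl x)

  lex-ins-≈ : ∀ {x x′} s → x ≈ x′ → lex (ins x s) (ins x′ s) ≡ eq
  lex-ins-≈ [] e = trans (lex-∷-eq e) refl
  lex-ins-≈ {x} {x′} (z ∷ s) e with cmp x z in e₁ | cmp x′ z in e₂
  ... | lt | lt = trans (lex-∷-eq (cmp-refl z)) (lex-ins-≈ s e)
  ... | lt | eq = case trans (sym e₁) (trans (≈-respˡ z e) e₂) of λ ()
  ... | lt | gt = case trans (sym e₁) (trans (≈-respˡ z e) e₂) of λ ()
  ... | eq | lt = case trans (sym e₁) (trans (≈-respˡ z e) e₂) of λ ()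
  ... | gt | lt = case trans (sym e₁) (trans (≈-respˡ z e) e₂) of λ ()
  ... | eq | eq = trans (lex-∷-eq e) (lex-refl _)
  ... | eq | gt = trans (lex-∷-eq e) (lex-refl _)
  ... | gt | eq = trans (lex-∷-eq e) (lex-refl _)
  ... | gt | gt = trans (lex-∷-eq e) (lex-refl _)

  private
    lex-ins-heads : ∀ x y r → ins x r ≡ x ∷ r → ins y r ≡ y ∷ r →
                    lex (ins x (y ∷ r)) (ins y (x ∷ r)) ≡ eq
    lex-ins-heads x y r hx hy with cmp x y in e
    ... | lt = trans (cong (λ w → lex (y ∷ w) (ins y (x ∷ r))) hx)
                     (trans (cong (lex (y ∷ x ∷ r)) (ins-≮ (≡gt⇒≢lt (<⇒> e)))) (lex-refl _))
    ... | eq = trans (cong (lex (x ∷ y ∷ r)) (ins-≮ (≡eq⇒≢lt (≈-sym e))))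
                     (trans (lex-∷-eq e) (trans (lex-∷-eq (≈-sym e)) (lex-refl r)))
    ... | gt = trans (cong (lex (x ∷ y ∷ r)) (ins-< (>⇒< e)))
                     (trans (cong (λ w → lex (x ∷ y ∷ r) (x ∷ w)) hy) (lex-refl _))

  lex-ins-comm : ∀ x y s → lex (ins x (ins y s)) (ins y (ins x s)) ≡ eq
  lex-ins-comm x y [] = lex-ins-heads x y [] refl refl
  lex-ins-comm x y (z ∷ s) with cmp y z in ey | cmp x z in ex
  ... | lt | lt = trans (cong₂ lex (ins-< ex) (ins-< ey)) (trans (lex-∷-eq (cmp-refl z)) (lex-ins-comm x y s))
  ... | eq | lt = trans (cong₂ lex (trans (ins-< (<-≤-trans ex (≡eq⇒≢gt (≈-sym ey)))) (cong (y ∷_) (ins-< ex)))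
                                   (ins-≮ λ h → ≡eq⇒≢lt ey h))
                        (lex-refl _)
  ... | gt | lt = trans (cong₂ lex (trans (ins-< (<-trans ex (>⇒< ey))) (cong (y ∷_) (ins-< ex)))
                                   (ins-≮ λ h → ≡gt⇒≢lt ey h))
                        (lex-refl _)
  ... | lt | eq = trans (cong₂ lex (ins-≮ λ h → ≡eq⇒≢lt ex h)
                                   (trans (ins-< (<-≤-trans ey (≡eq⇒≢gt (≈-sym ex)))) (cong (x ∷_) (ins-< ey))))
                        (lex-refl _)
  ... | lt | gt = trans (cong₂ lex (ins-≮ λ h → ≡gt⇒≢lt ex h)
                                   (trans (ins-< (<-trans ey (>⇒< ex))) (cong (x ∷_) (ins-< ey))))
                        (lex-refl _)
  ... | eq | eq = lex-ins-heads x y (z ∷ s) (ins-≮ λ h → ≡eq⇒≢lt ex h) (ins-≮ λ h → ≡eq⇒≢lt ey h)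
  ... | eq | gt = lex-ins-heads x y (z ∷ s) (ins-≮ λ h → ≡gt⇒≢lt ex h) (ins-≮ λ h → ≡eq⇒≢lt ey h)
  ... | gt | eq = lex-ins-heads x y (z ∷ s) (ins-≮ λ h → ≡eq⇒≢lt ex h) (ins-≮ λ h → ≡gt⇒≢lt ey h)
  ... | gt | gt = lex-ins-heads x y (z ∷ s) (ins-≮ λ h → ≡gt⇒≢lt ex h) (ins-≮ λ h → ≡gt⇒≢lt ey h)

  cmpMS-isComparison : IsComparison cmpMS
  cmpMS-isComparison = record
    { flip-cmp  = λ l m → lex-flip (sort l) (sort m)
    ; cmp-refl  = λ l → lex-refl (sort l)
    ; cmp-trans = λ l m n → lex-trans (sort l) (sort m) (sort n)
    }

  private
    module MS = IsComparison cmpMS-isComparison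

  cmpMS-∷ : ∀ {x x′} l m → x ≈ x′ → cmpMS (x ∷ l) (x′ ∷ m) ≡ cmpMS l m
  cmpMS-∷ {x} {x′} l m e =
    trans (Lex.≈-respˡ {ins x (sort l)} {ins x′ (sort l)} (ins x′ (sort m)) (lex-ins-≈ (sort l) e))
          (lex-ins x′ (sort l) (sort m))

  cmpMS-++ˡ : ∀ p l m → cmpMS (p ++ l) (p ++ m) ≡ cmpMS l m
  cmpMS-++ˡ [] l m = refl
  cmpMS-++ˡ (x ∷ p) l m = trans (cmpMS-∷ (p ++ l) (p ++ m) (cmp-refl x)) (cmpMS-++ˡ p l m)

  pointwise⇒≈ : ∀ {l m} → Pointwise _≈_ l m → cmpMS l m ≡ eq
  pointwise⇒≈ [] = refl
  pointwise⇒≈ {_ ∷ l} {_ ∷ m} (e ∷ p) = trans (cmpMS-∷ l m e) (pointwise⇒≈ p)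

  ↭⇒≈ : ∀ {l m} → l ↭ m → cmpMS l m ≡ eq
  ↭⇒≈ (↭-pointwise p) = pointwise⇒≈ p
  ↭⇒≈ (prep {l} {m} e p) = trans (cmpMS-∷ l m e) (↭⇒≈ p)
  ↭⇒≈ (swap {l} {m} {x} {y} {x′} {y′} e₁ e₂ p) =
    trans (MS.≈-respˡ {x ∷ y ∷ l} {y ∷ x ∷ l} (y′ ∷ x′ ∷ m) (lex-ins-comm x y (sort l)))
          (trans (cmpMS-∷ (x ∷ l) (x′ ∷ m) e₂) (trans (cmpMS-∷ l m e₁) (↭⇒≈ p)))
  ↭⇒≈ (↭.trans {l} {m} {n} p q) = MS.≈-trans {l} {m} {n} (↭⇒≈ p) (↭⇒≈ q)

  cmpMS-↭ : ∀ {l l′ m m′} → l ↭ l′ → m ↭ m′ → cmpMS l m ≡ cmpMS l′ m′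
  cmpMS-↭ {l} {l′} {m} {m′} p q =
    trans (MS.≈-respˡ {l} {l′} m (↭⇒≈ p)) (MS.≈-respʳ l′ {m} {m′} (↭⇒≈ q))

  cmpMS-++ʳ : ∀ p l m → cmpMS (l ++ p) (m ++ p) ≡ cmpMS l m
  cmpMS-++ʳ p l m = trans (cmpMS-↭ (++-comm l p) (++-comm m p)) (cmpMS-++ˡ p l m)

  ins-↭ : ∀ x s → ins x s ↭ x ∷ s
  ins-↭ x [] = ↭-refl
  ins-↭ x (z ∷ s) with cmp x z
  ... | lt = ↭-trans (prep (cmp-refl z) (ins-↭ x s)) (swap (cmp-refl z) (cmp-refl x) ↭-refl)
  ... | eq = ↭-refl
  ... | gt = ↭-refl

  sort-↭ : ∀ l → sort l ↭ l
  sort-↭ [] = ↭-refl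
  sort-↭ (x ∷ l) = ↭-trans (ins-↭ x (sort l)) (prep (cmp-refl x) (sort-↭ l))

  lex≡eq⇒pointwise : ∀ s t → lex s t ≡ eq → Pointwise _≈_ s t
  lex≡eq⇒pointwise [] [] _ = []
  lex≡eq⇒pointwise (x ∷ s) (y ∷ t) h with cmp x y in e
  ... | eq = e ∷ lex≡eq⇒pointwise s t h

  ≈⇒↭ : ∀ {l m} → cmpMS l m ≡ eq → l ↭ m
  ≈⇒↭ {l} {m} h =
    ↭-trans (↭-sym (sort-↭ l)) (↭-trans (↭-pointwise (lex≡eq⇒pointwise _ _ h)) (sort-↭ m))

  Sorted : List X → Set
  Sorted [] = ⊤
  Sorted (x ∷ l) = All (_≤ x) l × Sorted l

  All-ins : ∀ {P : X → Set} {x} s → All P s → P x → All P (ins x s)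
  All-ins [] [] px = px ∷ []
  All-ins {x = x} (z ∷ s) (pz ∷ ps) px with cmp x z
  ... | lt = pz ∷ All-ins s ps px
  ... | eq = px ∷ pz ∷ ps
  ... | gt = px ∷ pz ∷ ps

  All-sort : ∀ {P : X → Set} l → All P l → All P (sort l)
  All-sort [] [] = []
  All-sort (x ∷ l) (px ∷ pl) = All-ins (sort l) (All-sort l pl) px

  private
    ≮⇒sorted-∷ : ∀ {x z s} → cmp x z ≢ lt → Sorted (z ∷ s) → Sorted (x ∷ z ∷ s)
    ≮⇒sorted-∷ h (az , ss) = (z≤x ∷ All.map (λ w≤z → ≤-trans w≤z z≤x) az) , (az , ss)
      where z≤x = ≮⇒≥ h

  Sorted-ins : ∀ x s → Sorted s → Sorted (ins x s)
  Sorted-ins x [] _ = [] , tt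
  Sorted-ins x (z ∷ s) (az , ss) with cmp x z in e
  ... | lt = All-ins s az (≡lt⇒≢gt e) , Sorted-ins x s ss
  ... | eq = ≮⇒sorted-∷ (≡eq⇒≢lt e) (az , ss)
  ... | gt = ≮⇒sorted-∷ (≡gt⇒≢lt e) (az , ss)

  Sorted-sort : ∀ l → Sorted (sort l)
  Sorted-sort [] = tt
  Sorted-sort (x ∷ l) = Sorted-ins x (sort l) (Sorted-sort l)

  cmpMS-below : ∀ {z} l m → All (_< z) l → cmpMS l (z ∷ m) ≡ lt
  cmpMS-below {z} l m l<z = below (sort l) (All-sort l l<z) (ins-head (sort m))
    where
      ins-head : ∀ t → Σ X λ u → Σ (List X) λ r → (ins z t ≡ u ∷ r) × (z ≤ u)
      ins-head [] = z , [] , refl , ≡eq⇒≢gt (cmp-refl z)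
      ins-head (y ∷ t) with cmp z y in e
      ... | lt = y , ins z t , refl , ≡lt⇒≢gt e
      ... | eq = z , y ∷ t , refl , ≡eq⇒≢gt (cmp-refl z)
      ... | gt = z , y ∷ t , refl , ≡eq⇒≢gt (cmp-refl z)

      below : ∀ s → All (_< z) s → (Σ X λ u → Σ (List X) λ r → (ins z (sort m) ≡ u ∷ r) × (z ≤ u)) →
              lex s (ins z (sort m)) ≡ lt
      below [] _ (u , r , e , _) rewrite e = refl
      below (w ∷ s) (w<z ∷ _) (u , r , e , z≤u) rewrite e = lex-∷-lt (<-≤-trans w<z z≤u)

  record FirstDifference (a b : List X) : Set where
    field
      common rest₁ rest₂ : List X
      top : X
      a↭ : a ↭ common ++ top ∷ rest₁
      b↭ : b ↭ common ++ rest₂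
      rest₁≤top : All (_≤ top) rest₁
      rest₂<top : All (_< top) rest₂

  private
    sorted-first-difference : ∀ s t → Sorted s → Sorted t → lex s t ≡ gt → FirstDifference s t
    sorted-first-difference (x ∷ s) [] (s≤x , _) _ _ = record
      { common = [] ; rest₁ = s ; rest₂ = [] ; top = x ; a↭ = ↭-refl ; b↭ = ↭-refl
      ; rest₁≤top = s≤x ; rest₂<top = [] }
    sorted-first-difference (x ∷ s) (y ∷ t) (s≤x , ss) (t≤y , st) h with cmp x y in e
    ... | gt = record
      { common = [] ; rest₁ = s ; rest₂ = y ∷ t ; top = x ; a↭ = ↭-refl ; b↭ = ↭-refl
      ; rest₁≤top = s≤x ; rest₂<top = >⇒< e ∷ All.map (λ w≤y → ≤-<-trans w≤y (>⇒< e)) t≤y }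
    ... | eq = record
      { common = x ∷ common ; rest₁ = rest₁ ; rest₂ = rest₂ ; top = top
      ; a↭ = prep (cmp-refl x) a↭ ; b↭ = prep (≈-sym e) b↭
      ; rest₁≤top = rest₁≤top ; rest₂<top = rest₂<top }
      where open FirstDifference (sorted-first-difference s t ss st h)

  first-difference : ∀ a b → cmpMS b a ≡ lt → FirstDifference a b
  first-difference a b h = record
    { common = common ; rest₁ = rest₁ ; rest₂ = rest₂ ; top = top
    ; a↭ = ↭-trans (↭-sym (sort-↭ a)) a↭ ; b↭ = ↭-trans (↭-sym (sort-↭ b)) b↭
    ; rest₁≤top = rest₁≤top ; rest₂<top = rest₂<top }
    where
      open FirstDifference
        (sorted-first-difference (sort a) (sort b) (Sorted-sort a) (Sorted-sort b)
           (trans (lex-flip (sort b) (sort a)) (cong flipCmp h)))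

module Hessenberg (α : Ordinal) where

  open import Algebra.Bundles using (CommutativeSemiring)
  open import Algebra.Structures.Biased using (IsCommutativeSemiringˡ)
  open import Data.Empty using (⊥-elim)
  open import Data.List using (List; []; _∷_; _++_; map)
  open import Data.List.Properties using (++-identityʳ; ++-assoc; map-++; map-∘; map-cong; map-id)
  import Data.List.Relation.Binary.Pointwise as Pointwise
  open import Data.List.Relation.Unary.All using (All; []; _∷_)
  import Data.List.Relation.Unary.All as All
  import Data.List.Relation.Unary.All.Properties as Allₚ
  open import Data.Product using (_,_)
  open import Level using (0ℓ)
  open import Relation.Binary.Definitions using (tri<; tri≈; tri>)
  open import Relation.Binary.PropositionalEquality
  open import Relation.Binary.Structures using (IsStrictTotalOrder)

  open Ordinal α renaming (Carrier to O)
  open IsStrictTotalOrder isSTO using (compare) renaming (trans to <-trans)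
  open Ops α public

  cmpO : O → O → Cmp
  cmpO x y with compare x y
  ... | tri< _ _ _ = lt
  ... | tri≈ _ _ _ = eq
  ... | tri> _ _ _ = gt

  private
    cmpO-lt : ∀ {x y} → x < y → cmpO x y ≡ lt
    cmpO-lt {x} {y} p with compare x y
    ... | tri< _ _ _ = refl
    ... | tri≈ ¬p _ _ = ⊥-elim (¬p p)
    ... | tri> ¬p _ _ = ⊥-elim (¬p p)

    cmpO-gt : ∀ {x y} → y < x → cmpO x y ≡ gt
    cmpO-gt {x} {y} p with compare x y
    ... | tri< _ _ ¬p = ⊥-elim (¬p p)
    ... | tri≈ _ _ ¬p = ⊥-elim (¬p p)
    ... | tri> _ _ _ = refl

    cmpO-refl : ∀ x → cmpO x x ≡ eq
    cmpO-refl x with compare x x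
    ... | tri< x<x _ ¬x<x = ⊥-elim (¬x<x x<x)
    ... | tri≈ _ _ _ = refl
    ... | tri> ¬x<x _ x<x = ⊥-elim (¬x<x x<x)

    cmpO-lt⁻ : ∀ {x y} → cmpO x y ≡ lt → x < y
    cmpO-lt⁻ {x} {y} e with compare x y
    cmpO-lt⁻ refl | tri< p _ _ = p

    cmpO-eq⁻ : ∀ {x y} → cmpO x y ≡ eq → x ≡ y
    cmpO-eq⁻ {x} {y} e with compare x y
    cmpO-eq⁻ refl | tri≈ _ p _ = p

    cmpO-gt⁻ : ∀ {x y} → cmpO x y ≡ gt → y < x
    cmpO-gt⁻ {x} {y} e with compare x y
    cmpO-gt⁻ refl | tri> _ _ p = p

    cmpO-flip : ∀ x y → cmpO y x ≡ flipCmp (cmpO x y)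
    cmpO-flip x y with cmpO x y in e
    ... | lt = cmpO-gt (cmpO-lt⁻ e)
    ... | eq rewrite cmpO-eq⁻ e = cmpO-refl y
    ... | gt = cmpO-lt (cmpO-gt⁻ e)

    cmpO-trans : ∀ x y z → cmpO x y ≢ gt → cmpO y z ≢ gt → cmpO x z ≡ cmpO x y then cmpO y z
    cmpO-trans x y z h₁ h₂ with cmpO x y in e₁ | cmpO y z in e₂
    ... | gt | _ = ⊥-elim (h₁ refl)
    ... | _ | gt = ⊥-elim (h₂ refl)
    ... | lt | lt = cmpO-lt (<-trans (cmpO-lt⁻ e₁) (cmpO-lt⁻ e₂))
    ... | lt | eq rewrite cmpO-eq⁻ e₂ = e₁
    ... | eq | _ rewrite cmpO-eq⁻ e₁ = e₂

  cmpO-isComparison : IsComparison cmpO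
  cmpO-isComparison = record { flip-cmp = cmpO-flip ; cmp-refl = cmpO-refl ; cmp-trans = cmpO-trans }

  private
    module OMS = Multiset cmpO-isComparison

    insertO≡ins : ∀ x l → insertO x l ≡ OMS.ins x l
    insertO≡ins x [] = refl
    insertO≡ins x (y ∷ l) with compare x y
    ... | tri< _ _ _ = cong (y ∷_) (insertO≡ins x l)
    ... | tri≈ _ _ _ = refl
    ... | tri> _ _ _ = refl

    sortO≡sort : ∀ l → sortO l ≡ OMS.sort l
    sortO≡sort [] = refl
    sortO≡sort (x ∷ l) rewrite sortO≡sort l = insertO≡ins x (OMS.sort l)

    lexO≡lex : ∀ l m → lexO l m ≡ OMS.lex l m
    lexO≡lex [] [] = refl
    lexO≡lex [] (_ ∷ _) = refl
    lexO≡lex (_ ∷ _) [] = refl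
    lexO≡lex (x ∷ l) (y ∷ m) with compare x y
    ... | tri< _ _ _ = refl
    ... | tri≈ _ _ _ = lexO≡lex l m
    ... | tri> _ _ _ = refl

  cmpE≡cmpMS : ∀ e f → cmpE e f ≡ OMS.cmpMS e f
  cmpE≡cmpMS e f rewrite sortO≡sort e | sortO≡sort f = lexO≡lex (OMS.sort e) (OMS.sort f)

  cmpE-isComparison : IsComparison cmpE
  cmpE-isComparison = IsComparison-≗ cmpE≡cmpMS OMS.cmpMS-isComparison

  module EC = IsComparison cmpE-isComparison

  cmpE-++ˡ : ∀ p e f → cmpE (p ++ e) (p ++ f) ≡ cmpE e f
  cmpE-++ˡ p e f = trans (cmpE≡cmpMS (p ++ e) (p ++ f)) (trans (OMS.cmpMS-++ˡ p e f) (sym (cmpE≡cmpMS e f)))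

  cmpE-++ʳ : ∀ p e f → cmpE (e ++ p) (f ++ p) ≡ cmpE e f
  cmpE-++ʳ p e f = trans (cmpE≡cmpMS (e ++ p) (f ++ p)) (trans (OMS.cmpMS-++ʳ p e f) (sym (cmpE≡cmpMS e f)))

  cmpE-comm : ∀ e f → cmpE (e ++ f) (f ++ e) ≡ eq
  cmpE-comm e f = trans (cmpE≡cmpMS (e ++ f) (f ++ e)) (OMS.↭⇒≈ (OMS.++-comm e f))

  module EMS = Multiset cmpE-isComparison
  open EMS public
    using (_↭_; ↭-refl; ↭-sym; ↭-trans; ↭-reflexive; ↭-pointwise; ++⁺; ++-comm; shifts)
  open import Data.List.Relation.Binary.Permutation.Setoid.Properties EC.≈-setoid using (map⁺)

  private
    insertE≡ins : ∀ x l → insertE x l ≡ EMS.ins x l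
    insertE≡ins x [] = refl
    insertE≡ins x (y ∷ l) with cmpE x y
    ... | lt = cong (y ∷_) (insertE≡ins x l)
    ... | eq = refl
    ... | gt = refl

    sortE≡sort : ∀ l → sortE l ≡ EMS.sort l
    sortE≡sort [] = refl
    sortE≡sort (x ∷ l) rewrite sortE≡sort l = insertE≡ins x (EMS.sort l)

    lexE≡lex : ∀ l m → lexE l m ≡ EMS.lex l m
    lexE≡lex [] [] = refl
    lexE≡lex [] (_ ∷ _) = refl
    lexE≡lex (_ ∷ _) [] = refl
    lexE≡lex (x ∷ l) (y ∷ m) with cmpE x y
    ... | lt = refl
    ... | eq = lexE≡lex l m
    ... | gt = refl

  cmpN≡cmpMS : ∀ a b → cmpN a b ≡ EMS.cmpMS a b
  cmpN≡cmpMS a b rewrite sortE≡sort a | sortE≡sort b = lexE≡lex (EMS.sort a) (EMS.sort b)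

  cmpN-isComparison : IsComparison cmpN
  cmpN-isComparison = IsComparison-≗ cmpN≡cmpMS EMS.cmpMS-isComparison

  module NC = IsComparison cmpN-isComparison

  cmpN-↭ : ∀ {a a′ b b′} → a ↭ a′ → b ↭ b′ → cmpN a b ≡ cmpN a′ b′
  cmpN-↭ {a} {a′} {b} {b′} p q = trans (cmpN≡cmpMS a b) (trans (EMS.cmpMS-↭ p q) (sym (cmpN≡cmpMS a′ b′)))

  ↭⇒≈N : ∀ {a b} → a ↭ b → a ≈N b
  ↭⇒≈N {a} {b} p = trans (cmpN≡cmpMS a b) (EMS.↭⇒≈ p)

  ≈N⇒↭ : ∀ {a b} → a ≈N b → a ↭ b
  ≈N⇒↭ {a} {b} h = EMS.≈⇒↭ (trans (sym (cmpN≡cmpMS a b)) h)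

  cmpN-++ˡ : ∀ p a b → cmpN (p ++ a) (p ++ b) ≡ cmpN a b
  cmpN-++ˡ p a b = trans (cmpN≡cmpMS (p ++ a) (p ++ b)) (trans (EMS.cmpMS-++ˡ p a b) (sym (cmpN≡cmpMS a b)))

  cmpN-++ʳ : ∀ p a b → cmpN (a ++ p) (b ++ p) ≡ cmpN a b
  cmpN-++ʳ p a b = trans (cmpN≡cmpMS (a ++ p) (b ++ p)) (trans (EMS.cmpMS-++ʳ p a b) (sym (cmpN≡cmpMS a b)))

  *N-distribʳ : ∀ a a′ b → (a ++ a′) *N b ≡ (a *N b) ++ (a′ *N b)
  *N-distribʳ [] a′ b = refl
  *N-distribʳ (x ∷ a) a′ b =
    trans (cong (map (x ++_) b ++_) (*N-distribʳ a a′ b)) (sym (++-assoc (map (x ++_) b) _ _))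

  *N-zeroʳ : ∀ a → a *N [] ≡ []
  *N-zeroʳ [] = refl
  *N-zeroʳ (x ∷ a) = *N-zeroʳ a

  *N-identityˡ : ∀ b → 1N *N b ≡ b
  *N-identityˡ b = trans (++-identityʳ (map ([] ++_) b)) (map-id b)

  *N-identityʳ : ∀ a → a *N 1N ≡ a
  *N-identityʳ [] = refl
  *N-identityʳ (x ∷ a) = cong₂ _∷_ (++-identityʳ x) (*N-identityʳ a)

  map-*N : ∀ e b c → map (e ++_) b *N c ≡ map (e ++_) (b *N c)
  map-*N e [] c = refl
  map-*N e (f ∷ b) c =
    trans (cong₂ _++_ (trans (map-cong (++-assoc e f) c) (map-∘ c))
                      (map-*N e b c))
          (sym (map-++ (e ++_) (map (f ++_) c) (b *N c)))

  *N-assoc : ∀ a b c → (a *N b) *N c ≡ a *N (b *N c)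
  *N-assoc [] b c = refl
  *N-assoc (x ∷ a) b c = trans (*N-distribʳ (map (x ++_) b) (a *N b) c) (cong₂ _++_ (map-*N x b c) (*N-assoc a b c))

  map-≈ : ∀ (f g : E → E) → (∀ x → cmpE (f x) (g x) ≡ eq) → ∀ l → map f l ↭ map g l
  map-≈ f g f≈g l = ↭-pointwise (Pointwise.map⁺ f g (Pointwise.refl (λ {x} → f≈g x)))

  *N-congˡ : ∀ a {b b′} → b ↭ b′ → a *N b ↭ a *N b′
  *N-congˡ [] p = ↭-refl
  *N-congˡ (x ∷ a) {b} {b′} p =
    ++⁺ (map⁺ EC.≈-setoid (λ {u} {v} e → trans (cmpE-++ˡ x u v) e) p) (*N-congˡ a p)

  *N-∷ʳ : ∀ a f b → a *N (f ∷ b) ↭ map (_++ f) a ++ (a *N b)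
  *N-∷ʳ [] f b = ↭-refl
  *N-∷ʳ (x ∷ a) f b = EMS.prep (EC.cmp-refl (x ++ f))
    (↭-trans (++⁺ (↭-refl {map (x ++_) b}) (*N-∷ʳ a f b)) (shifts (map (x ++_) b) (map (_++ f) a)))

  *N-comm : ∀ a b → a *N b ↭ b *N a
  *N-comm a [] = ↭-reflexive (*N-zeroʳ a)
  *N-comm a (f ∷ b) = ↭-trans (*N-∷ʳ a f b) (++⁺ (map-≈ (_++ f) (f ++_) (λ x → cmpE-comm x f) a) (*N-comm a b))

  *N-congʳ : ∀ {a a′} b → a ↭ a′ → a *N b ↭ a′ *N b
  *N-congʳ {a} {a′} b p = ↭-trans (*N-comm a b) (↭-trans (*N-congˡ b p) (*N-comm b a′))

  ℕα-commutativeSemiring : CommutativeSemiring 0ℓ 0ℓ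
  ℕα-commutativeSemiring = record
    { Carrier = N ; _≈_ = _↭_ ; _+_ = _+N_ ; _*_ = _*N_ ; 0# = 0N ; 1# = 1N
    ; isCommutativeSemiring = IsCommutativeSemiringˡ.isCommutativeSemiring (record
        { +-isCommutativeMonoid = EMS.++-isCommutativeMonoid
        ; *-isCommutativeMonoid = record
            { isMonoid = record
                { isSemigroup = record
                    { isMagma = record
                        { isEquivalence = EMS.↭-isEquivalence
                        ; ∙-cong = λ {a} {a′} {b} {b′} p q → ↭-trans (*N-congʳ b p) (*N-congˡ a′ q) }
                    ; assoc = λ a b c → ↭-reflexive (*N-assoc a b c) }
                ; identity = (λ a → ↭-reflexive (*N-identityˡ a)) , (λ a → ↭-reflexive (*N-identityʳ a)) }
            ; comm = *N-comm }
        ; distribʳ = λ a b c → ↭-reflexive (*N-distribʳ b c a)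
        ; zeroˡ = λ _ → ↭-refl })
    }

  private
    All-*N : ∀ {P Q T : E → Set} {l m} → All P l → All Q m →
             (∀ {e f} → P e → Q f → T (e ++ f)) → All T (l *N m)
    All-*N [] _ _ = []
    All-*N (pe ∷ pl) qm t = Allₚ.++⁺ (Allₚ.map⁺ (All.map (t pe) qm)) (All-*N pl qm t)

    ++-≤-< : ∀ {e f x y} → cmpE e x ≢ gt → cmpE f y ≡ lt → cmpE (e ++ f) (x ++ y) ≡ lt
    ++-≤-< {e} {f} {x} {y} e≤x f<y =
      EC.≤-<-trans {e ++ f} {x ++ f} {x ++ y} (λ q → e≤x (trans (sym (cmpE-++ʳ f e x)) q)) (trans (cmpE-++ˡ x f y) f<y)

    ++-<-≤ : ∀ {e f x y} → cmpE e x ≡ lt → cmpE f y ≢ gt → cmpE (e ++ f) (x ++ y) ≡ lt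
    ++-<-≤ {e} {f} {x} {y} e<x f≤y =
      EC.<-≤-trans {e ++ f} {x ++ f} {x ++ y} (trans (cmpE-++ʳ f e x) e<x) (λ q → f≤y (trans (sym (cmpE-++ˡ x f y)) q))

  open import Algebra.Solver.Ring.NaturalCoefficients.Default ℕα-commutativeSemiring
    using (solve; _:+_; _:*_; _:=_)

  open CommutativeSemiring ℕα-commutativeSemiring using (*-cong)

  -- Write a₁ ↭ P + X, a₂ ↭ P + R, b₁ ↭ Q + Y, b₂ ↭ Q + S as given by the first
  -- differences, with X = x ∷ _ and Y = y ∷ _.  After cancelling the common part,
  -- the right side contains the term x ++ y, which exceeds every term of X S + R Y.
  *N-cross-< : ∀ a₁ a₂ b₁ b₂ → cmpN a₂ a₁ ≡ lt → cmpN b₂ b₁ ≡ lt →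
               cmpN ((a₁ *N b₂) ++ (a₂ *N b₁)) ((a₁ *N b₁) ++ (a₂ *N b₂)) ≡ lt
  *N-cross-< a₁ a₂ b₁ b₂ a₂<a₁ b₂<b₁ = begin
    cmpN ((a₁ *N b₂) ++ (a₂ *N b₁)) ((a₁ *N b₁) ++ (a₂ *N b₂)) ≡⟨ cmpN-↭ lhs rhs ⟩
    cmpN (c ++ ((X *N s) ++ (r *N Y))) (c ++ ((X *N Y) ++ (r *N s))) ≡⟨ cmpN-++ˡ c low high ⟩
    cmpN ((X *N s) ++ (r *N Y)) ((X *N Y) ++ (r *N s))                ≡⟨ cmpN≡cmpMS low high ⟩
    EMS.cmpMS ((X *N s) ++ (r *N Y)) ((x ++ y) ∷ rest)                ≡⟨ EMS.cmpMS-below _ rest below ⟩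
    lt                                                               ∎
    where
      open ≡-Reasoning
      module A = EMS.FirstDifference (EMS.first-difference a₁ a₂ (trans (sym (cmpN≡cmpMS a₂ a₁)) a₂<a₁))
      module B = EMS.FirstDifference (EMS.first-difference b₁ b₂ (trans (sym (cmpN≡cmpMS b₂ b₁)) b₂<b₁))
      p = A.common
      r = A.rest₂
      x = A.top
      X = x ∷ A.rest₁
      q = B.common
      s = B.rest₂
      y = B.top
      Y = y ∷ B.rest₁
      low = (X *N s) ++ (r *N Y)
      high = (X *N Y) ++ (r *N s)
      rest = (map (x ++_) B.rest₁ ++ (A.rest₁ *N Y)) ++ (r *N s)
      c = ((p *N q) ++ (p *N q)) ++ (((p *N s) ++ (p *N Y)) ++ ((X *N q) ++ (r *N q)))

      lhs : (a₁ *N b₂) ++ (a₂ *N b₁) ↭ c ++ ((X *N s) ++ (r *N Y))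
      lhs = ↭-trans (++⁺ (*-cong A.a↭ B.b↭) (*-cong A.b↭ B.a↭))
        (solve 6 (λ P X R Q Y S → ((P :+ X) :* (Q :+ S)) :+ ((P :+ R) :* (Q :+ Y))
                    := (((P :* Q) :+ (P :* Q)) :+ (((P :* S) :+ (P :* Y)) :+ ((X :* Q) :+ (R :* Q))))
                       :+ ((X :* S) :+ (R :* Y)))
           ↭-refl p X r q Y s)

      rhs : (a₁ *N b₁) ++ (a₂ *N b₂) ↭ c ++ ((X *N Y) ++ (r *N s))
      rhs = ↭-trans (++⁺ (*-cong A.a↭ B.a↭) (*-cong A.b↭ B.b↭))
        (solve 6 (λ P X R Q Y S → ((P :+ X) :* (Q :+ Y)) :+ ((P :+ R) :* (Q :+ S))
                    := (((P :* Q) :+ (P :* Q)) :+ (((P :* S) :+ (P :* Y)) :+ ((X :* Q) :+ (R :* Q))))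
                       :+ ((X :* Y) :+ (R :* S)))
           ↭-refl p X r q Y s)

      below : All (λ e → cmpE e (x ++ y) ≡ lt) ((X *N s) ++ (r *N Y))
      below = Allₚ.++⁺ (All-*N (≡eq⇒≢gt (EC.cmp-refl x) ∷ A.rest₁≤top) B.rest₂<top (λ {e} {f} → ++-≤-< {e} {f} {x} {y}))
                      (All-*N A.rest₂<top (≡eq⇒≢gt (EC.cmp-refl y) ∷ B.rest₁≤top) (λ {e} {f} → ++-<-≤ {e} {f} {x} {y}))

module Integers (α : Ordinal) where

  open import Algebra.Bundles using (CommutativeRing)
  open import Algebra.Solver.Ring.AlmostCommutativeRing using (fromCommutativeRing)
  import Algebra.Solver.Ring.Simple
  import Algebra.Properties.Group
  open import Data.Bool using (true; false)
  open import Data.Empty using (⊥-elim)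
  open import Data.List using (_++_)
  open import Data.List.Properties using (++-identityʳ)
  open import Data.Product using (_,_; proj₁; proj₂)
  open import Function using (case_of_)
  open import Level using (0ℓ)
  open import Relation.Binary.PropositionalEquality
  open import Relation.Nullary using (¬_; Dec; yes; no)

  open Hessenberg α public

  private
    module ℕα = Algebra.Bundles.CommutativeSemiring ℕα-commutativeSemiring
  open import Algebra.Solver.Ring.NaturalCoefficients.Default ℕα-commutativeSemiring
    using (solve; _:+_; _:*_; _:=_; con)

  cmpZ : Z → Z → Cmp
  cmpZ (u₁ , u₂) (v₁ , v₂) = cmpN (u₁ ++ v₂) (v₁ ++ u₂)

  cmpN-++ : ∀ a a′ b b′ → cmpN a a′ ≢ gt → cmpN b b′ ≢ gt →
            cmpN (a ++ b) (a′ ++ b′) ≡ cmpN a a′ then cmpN b b′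
  cmpN-++ a a′ b b′ h₁ h₂ =
    trans (NC.cmp-trans (a ++ b) (a′ ++ b) (a′ ++ b′) (λ q → h₁ (trans (sym (cmpN-++ʳ b a a′)) q))
                                                      (λ q → h₂ (trans (sym (cmpN-++ˡ a′ b b′)) q)))
          (cong₂ _then_ (cmpN-++ʳ b a a′) (cmpN-++ˡ a′ b b′))

  cmpZ-isComparison : IsComparison cmpZ
  cmpZ-isComparison = record
    { flip-cmp  = λ { (u₁ , u₂) (v₁ , v₂) → NC.flip-cmp (u₁ ++ v₂) (v₁ ++ u₂) }
    ; cmp-refl  = λ { (u₁ , u₂) → NC.cmp-refl (u₁ ++ u₂) }
    ; cmp-trans = λ { (u₁ , u₂) (v₁ , v₂) (w₁ , w₂) h₁ h₂ →
        trans (sym (cmpN-++ʳ (v₁ ++ v₂) (u₁ ++ w₂) (w₁ ++ u₂)))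
          (trans (cmpN-↭ (solve 4 (λ u₁ w₂ v₁ v₂ → (u₁ :+ w₂) :+ (v₁ :+ v₂) := (u₁ :+ v₂) :+ (v₁ :+ w₂))
                            ↭-refl u₁ w₂ v₁ v₂)
                         (solve 4 (λ w₁ u₂ v₁ v₂ → (w₁ :+ u₂) :+ (v₁ :+ v₂) := (v₁ :+ u₂) :+ (w₁ :+ v₂))
                            ↭-refl w₁ u₂ v₁ v₂))
                 (cmpN-++ (u₁ ++ v₂) (v₁ ++ u₂) (v₁ ++ w₂) (w₁ ++ v₂) h₁ h₂)) }
    }

  module ZC = IsComparison cmpZ-isComparison

  infix 4 _≃_

  record _≃_ (u v : Z) : Set where
    constructor mk≃
    field ≃⇒↭ : proj₁ u ++ proj₂ v ↭ proj₁ v ++ proj₂ u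

  open _≃_ public

  ≃⇒cmpZ≡eq : ∀ {u v} → u ≃ v → cmpZ u v ≡ eq
  ≃⇒cmpZ≡eq p = ↭⇒≈N (≃⇒↭ p)

  cmpZ≡eq⇒≃ : ∀ {u v} → cmpZ u v ≡ eq → u ≃ v
  cmpZ≡eq⇒≃ h = mk≃ (≈N⇒↭ h)

  ≈Z⇒≃ : ∀ {u v} → u ≈Z v → u ≃ v
  ≈Z⇒≃ {a , b} {c , d} h = mk≃ (↭-trans (≈N⇒↭ h) (++-comm b c))

  ≃⇒≈Z : ∀ {u v} → u ≃ v → u ≈Z v
  ≃⇒≈Z {a , b} {c , d} p = ↭⇒≈N (↭-trans (≃⇒↭ p) (++-comm c b))

  1Z : Z
  1Z = (1N , 0N)

  private
    ≃-trans : ∀ {u v w} → u ≃ v → v ≃ w → u ≃ w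
    ≃-trans {a , b} {c , d} {e , f} (mk≃ p) (mk≃ q) =
      mk≃ (≈N⇒↭ (trans (sym (cmpN-++ʳ (c ++ d) (a ++ f) (e ++ b))) (↭⇒≈N chain)))
      where
        chain : (a ++ f) ++ (c ++ d) ↭ (e ++ b) ++ (c ++ d)
        chain = ↭-trans (solve 4 (λ a f c d → (a :+ f) :+ (c :+ d) := (a :+ d) :+ (c :+ f)) ↭-refl a f c d)
               (↭-trans (++⁺ p q)
                        (solve 4 (λ c b e d → (c :+ b) :+ (e :+ d) := (e :+ b) :+ (c :+ d)) ↭-refl c b e d))

    +Z-cong : ∀ {u u′ v v′} → u ≃ u′ → v ≃ v′ → u +Z v ≃ u′ +Z v′
    +Z-cong {u₁ , u₂} {u₁′ , u₂′} {v₁ , v₂} {v₁′ , v₂′} (mk≃ p) (mk≃ q) = mk≃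
      (↭-trans (solve 4 (λ a b c d → (a :+ b) :+ (c :+ d) := (a :+ c) :+ (b :+ d)) ↭-refl u₁ v₁ u₂′ v₂′)
      (↭-trans (++⁺ p q)
               (solve 4 (λ a b c d → (a :+ c) :+ (b :+ d) := (a :+ b) :+ (c :+ d)) ↭-refl u₁′ v₁′ u₂ v₂)))

    -Z-cong : ∀ {u u′} → u ≃ u′ → -Z u ≃ -Z u′
    -Z-cong {u₁ , u₂} {u₁′ , u₂′} (mk≃ p) = mk≃ (↭-trans (++-comm u₂ u₁′) (↭-trans (↭-sym p) (++-comm u₁ u₂′)))

    *Z-congʳ : ∀ {u u′} v → u ≃ u′ → u *Z v ≃ u′ *Z v
    *Z-congʳ {u₁ , u₂} {u₁′ , u₂′} (v₁ , v₂) (mk≃ p) = mk≃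
      (↭-trans (solve 6 (λ u₁ u₂ u₁′ u₂′ v₁ v₂ → ((u₁ :* v₁) :+ (u₂ :* v₂)) :+ ((u₁′ :* v₂) :+ (u₂′ :* v₁))
                            := ((u₁ :+ u₂′) :* v₁) :+ ((u₁′ :+ u₂) :* v₂)) ↭-refl u₁ u₂ u₁′ u₂′ v₁ v₂)
      (↭-trans (++⁺ (ℕα.*-cong p ↭-refl) (ℕα.*-cong (↭-sym p) ↭-refl))
               (solve 6 (λ u₁ u₂ u₁′ u₂′ v₁ v₂ → ((u₁′ :+ u₂) :* v₁) :+ ((u₁ :+ u₂′) :* v₂)
                            := ((u₁′ :* v₁) :+ (u₂′ :* v₂)) :+ ((u₁ :* v₂) :+ (u₂ :* v₁))) ↭-refl u₁ u₂ u₁′ u₂′ v₁ v₂)))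

    *Z-comm : ∀ u v → u *Z v ≃ v *Z u
    *Z-comm (a , b) (c , d) = mk≃ (solve 4 (λ a b c d → ((a :* c) :+ (b :* d)) :+ ((c :* b) :+ (d :* a))
                                            := ((c :* a) :+ (d :* b)) :+ ((a :* d) :+ (b :* c))) ↭-refl a b c d)

    ≃-sym : ∀ {u v} → u ≃ v → v ≃ u
    ≃-sym (mk≃ p) = mk≃ (↭-sym p)

    *Z-cong : ∀ {u u′ v v′} → u ≃ u′ → v ≃ v′ → u *Z v ≃ u′ *Z v′
    *Z-cong {u} {u′} {v} {v′} p q =
      ≃-trans (*Z-congʳ v p) (≃-trans (*Z-comm u′ v) (≃-trans (*Z-congʳ u′ q) (*Z-comm v′ u′)))

    +Z-assoc : ∀ u v w → (u +Z v) +Z w ≃ u +Z (v +Z w)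
    +Z-assoc (a , b) (c , d) (e , f) = mk≃ (solve 6 (λ a b c d e f →
      ((a :+ c) :+ e) :+ (b :+ (d :+ f)) := (a :+ (c :+ e)) :+ ((b :+ d) :+ f)) ↭-refl a b c d e f)

    +Z-comm : ∀ u v → u +Z v ≃ v +Z u
    +Z-comm (a , b) (c , d) = mk≃ (solve 4 (λ a b c d →
      (a :+ c) :+ (d :+ b) := (c :+ a) :+ (b :+ d)) ↭-refl a b c d)

    +Z-identityʳ : ∀ u → u +Z 0Z ≃ u
    +Z-identityʳ (a , b) = mk≃ (solve 2 (λ a b → (a :+ con 0) :+ b := a :+ (b :+ con 0)) ↭-refl a b)

    -Z-inverseˡ : ∀ u → (-Z u) +Z u ≃ 0Z
    -Z-inverseˡ (a , b) = mk≃ (solve 2 (λ a b → (b :+ a) :+ con 0 := con 0 :+ (a :+ b)) ↭-refl a b)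

    -Z-inverseʳ : ∀ u → u +Z (-Z u) ≃ 0Z
    -Z-inverseʳ (a , b) = mk≃ (solve 2 (λ a b → (a :+ b) :+ con 0 := con 0 :+ (b :+ a)) ↭-refl a b)

    *Z-assoc : ∀ u v w → (u *Z v) *Z w ≃ u *Z (v *Z w)
    *Z-assoc (a , b) (c , d) (e , f) = mk≃ (solve 6 (λ a b c d e f →
      ((((a :* c) :+ (b :* d)) :* e) :+ (((a :* d) :+ (b :* c)) :* f))
        :+ ((a :* ((c :* f) :+ (d :* e))) :+ (b :* ((c :* e) :+ (d :* f))))
      := ((a :* ((c :* e) :+ (d :* f))) :+ (b :* ((c :* f) :+ (d :* e))))
        :+ ((((a :* c) :+ (b :* d)) :* f) :+ (((a :* d) :+ (b :* c)) :* e)))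
      ↭-refl a b c d e f)

    *Z-identityˡ : ∀ u → 1Z *Z u ≃ u
    *Z-identityˡ (a , b) = mk≃ (solve 2 (λ a b →
      ((con 1 :* a) :+ (con 0 :* b)) :+ b := a :+ ((con 1 :* b) :+ (con 0 :* a))) ↭-refl a b)

    *Z-identityʳ : ∀ u → u *Z 1Z ≃ u
    *Z-identityʳ (a , b) = mk≃ (solve 2 (λ a b →
      ((a :* con 1) :+ (b :* con 0)) :+ b := a :+ ((a :* con 0) :+ (b :* con 1))) ↭-refl a b)

    *Z-distribˡ : ∀ u v w → u *Z (v +Z w) ≃ (u *Z v) +Z (u *Z w)
    *Z-distribˡ (a , b) (c , d) (e , f) = mk≃ (solve 6 (λ a b c d e f →
      ((a :* (c :+ e)) :+ (b :* (d :+ f))) :+ (((a :* d) :+ (b :* c)) :+ ((a :* f) :+ (b :* e)))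
      := (((a :* c) :+ (b :* d)) :+ ((a :* e) :+ (b :* f))) :+ ((a :* (d :+ f)) :+ (b :* (c :+ e))))
      ↭-refl a b c d e f)

    *Z-distribʳ : ∀ u v w → (v +Z w) *Z u ≃ (v *Z u) +Z (w *Z u)
    *Z-distribʳ (a , b) (c , d) (e , f) = mk≃ (solve 6 (λ a b c d e f →
      (((c :+ e) :* a) :+ ((d :+ f) :* b)) :+ (((c :* b) :+ (d :* a)) :+ ((e :* b) :+ (f :* a)))
      := (((c :* a) :+ (d :* b)) :+ ((e :* a) :+ (f :* b))) :+ (((c :+ e) :* b) :+ ((d :+ f) :* a)))
      ↭-refl a b c d e f)

  ℤα-commutativeRing : CommutativeRing 0ℓ 0ℓ
  ℤα-commutativeRing = record
    { Carrier = Z ; _≈_ = _≃_ ; _+_ = _+Z_ ; _*_ = _*Z_ ; -_ = -Z_ ; 0# = 0Z ; 1# = 1Z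
    ; isCommutativeRing = record
      { isRing = record
        { +-isAbelianGroup = record
          { isGroup = record
            { isMonoid = record
              { isSemigroup = record
                { isMagma = record
                  { isEquivalence = record { refl = mk≃ ↭-refl ; sym = ≃-sym ; trans = ≃-trans }
                  ; ∙-cong = +Z-cong }
                ; assoc = +Z-assoc }
              ; identity = (λ _ → mk≃ ↭-refl) , +Z-identityʳ }
            ; inverse = -Z-inverseˡ , -Z-inverseʳ
            ; ⁻¹-cong = -Z-cong }
          ; comm = +Z-comm }
        ; *-cong = *Z-cong
        ; *-assoc = *Z-assoc
        ; *-identity = *Z-identityˡ , *Z-identityʳ
        ; distrib = *Z-distribˡ , *Z-distribʳ }
      ; *-comm = *Z-comm } }

  module ℤα = CommutativeRing ℤα-commutativeRing

  private
    ≡eq? : ∀ c → Dec (c ≡ eq)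
    ≡eq? lt = no λ ()
    ≡eq? eq = yes refl
    ≡eq? gt = no λ ()

  _≃?_ : ∀ u v → Dec (u ≃ v)
  u ≃? v with ≡eq? (cmpZ u v)
  ... | yes p = yes (cmpZ≡eq⇒≃ p)
  ... | no ¬p = no λ q → ¬p (≃⇒cmpZ≡eq q)

  module ZS = Algebra.Solver.Ring.Simple (fromCommutativeRing ℤα-commutativeRing) _≃?_
  open Algebra.Properties.Group ℤα.+-group public using (x∙y⁻¹≈ε⇒x≈y; x≈y⇒x∙y⁻¹≈ε)

  cmpZ-+ʳ : ∀ u v w → cmpZ (u +Z w) (v +Z w) ≡ cmpZ u v
  cmpZ-+ʳ (u₁ , u₂) (v₁ , v₂) (w₁ , w₂) =
    trans (cmpN-↭ (solve 4 (λ a b c d → (a :+ b) :+ (c :+ d) := (a :+ c) :+ (b :+ d)) ↭-refl u₁ w₁ v₂ w₂)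
                  (solve 4 (λ a b c d → (a :+ b) :+ (c :+ d) := (a :+ c) :+ (b :+ d)) ↭-refl v₁ w₁ u₂ w₂))
          (cmpN-++ʳ (w₁ ++ w₂) (u₁ ++ v₂) (v₁ ++ u₂))

  cmpZ-neg : ∀ u v → cmpZ (-Z u) (-Z v) ≡ cmpZ v u
  cmpZ-neg (u₁ , u₂) (v₁ , v₂) = cmpN-↭ (++-comm u₂ v₁) (++-comm v₂ u₁)

  cmpZ0-resp : ∀ {u v} → u ≃ v → cmpZ 0Z u ≡ cmpZ 0Z v
  cmpZ0-resp {u} {v} p = ZC.≈-respʳ 0Z {u} {v} (≃⇒cmpZ≡eq p)

  cmpZ0-neg : ∀ w → cmpZ 0Z (-Z w) ≡ flipCmp (cmpZ 0Z w)
  cmpZ0-neg w = trans (cmpZ-neg 0Z w) (ZC.flip-cmp 0Z w)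

  cmpZ0≡eq⇒≃0 : ∀ {w} → cmpZ 0Z w ≡ eq → w ≃ 0Z
  cmpZ0≡eq⇒≃0 {w} h = cmpZ≡eq⇒≃ (ZC.≈-sym {0Z} {w} h)

  cmpZ0-+ : ∀ u v → cmpZ 0Z u ≢ gt → cmpZ 0Z v ≢ gt → cmpZ 0Z (u +Z v) ≡ cmpZ 0Z u then cmpZ 0Z v
  cmpZ0-+ u v h₁ h₂ =
    trans (ZC.cmp-trans 0Z u (u +Z v) h₁ (λ q → h₂ (trans (sym u≤u+v) q))) (cong (cmpZ 0Z u then_) u≤u+v)
    where
      u≤u+v : cmpZ u (u +Z v) ≡ cmpZ 0Z v
      u≤u+v = trans (ZC.≈-respʳ u {u +Z v} {v +Z u} (≃⇒cmpZ≡eq (ℤα.+-comm u v))) (cmpZ-+ʳ 0Z v u)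

  0<* : ∀ u v → cmpZ 0Z u ≡ lt → cmpZ 0Z v ≡ lt → cmpZ 0Z (u *Z v) ≡ lt
  0<* (u₁ , u₂) (v₁ , v₂) 0<u 0<v =
    subst (λ t → cmpN ((u₁ *N v₂) ++ (u₂ *N v₁)) t ≡ lt) (sym (++-identityʳ ((u₁ *N v₁) ++ (u₂ *N v₂))))
          (*N-cross-< u₁ u₂ v₁ v₂ (subst (λ t → cmpN u₂ t ≡ lt) (++-identityʳ u₁) 0<u)
                                  (subst (λ t → cmpN v₂ t ≡ lt) (++-identityʳ v₁) 0<v))

  cmpZ0-*-pos : ∀ w p → cmpZ 0Z p ≡ lt → cmpZ 0Z (w *Z p) ≡ cmpZ 0Z w
  cmpZ0-*-pos w p 0<p with cmpZ 0Z w in e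
  ... | lt = 0<* w p e 0<p
  ... | eq = cmpZ0-resp {w *Z p} {0Z} (ℤα.trans (ℤα.*-cong (cmpZ0≡eq⇒≃0 {w} e) ℤα.refl) (ℤα.zeroˡ p))
  ... | gt = flipCmp-lt (trans (sym (cmpZ0-neg (w *Z p)))
               (trans (cmpZ0-resp { -Z (w *Z p)} {(-Z w) *Z p} (ZS.solve 2 (λ w p → ZS.:- (w ZS.:* p) ZS.:= (ZS.:- w) ZS.:* p) ℤα.refl w p))
                      (0<* (-Z w) p (trans (cmpZ0-neg w) (cong flipCmp e)) 0<p)))
    where
      flipCmp-lt : ∀ {c} → flipCmp c ≡ lt → c ≡ gt
      flipCmp-lt {gt} _ = refl

  0<² : ∀ d → ¬ d ≃ 0Z → cmpZ 0Z (d *Z d) ≡ lt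
  0<² d d≄0 with cmpZ 0Z d in e
  ... | lt = 0<* d d e e
  ... | eq = ⊥-elim (d≄0 (cmpZ0≡eq⇒≃0 {d} e))
  ... | gt = trans (cmpZ0-resp {d *Z d} {(-Z d) *Z (-Z d)} (ZS.solve 1 (λ d → d ZS.:* d ZS.:= (ZS.:- d) ZS.:* (ZS.:- d)) ℤα.refl d))
                   (0<* (-Z d) (-Z d) 0<-d 0<-d)
    where 0<-d = trans (cmpZ0-neg d) (cong flipCmp e)

  *-≄0 : ∀ a b → ¬ a ≃ 0Z → ¬ b ≃ 0Z → ¬ (a *Z b) ≃ 0Z
  *-≄0 a b a≄0 b≄0 ab≃0 = case trans (sym (0<* (a *Z a) (b *Z b) (0<² a a≄0) (0<² b b≄0))) (cmpZ0-resp {(a *Z a) *Z (b *Z b)} {0Z} sq≃0) of λ ()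
    where
      sq≃0 : (a *Z a) *Z (b *Z b) ≃ 0Z
      sq≃0 = ℤα.trans (ZS.solve 2 (λ a b → (a ZS.:* a) ZS.:* (b ZS.:* b) ZS.:= (a ZS.:* b) ZS.:* (a ZS.:* b)) ℤα.refl a b)
                      (ℤα.trans (ℤα.*-cong ab≃0 ℤα.refl) (ℤα.zeroˡ (a *Z b)))

  *-cancelʳ-≃0 : ∀ w d → ¬ d ≃ 0Z → (w *Z d) ≃ 0Z → w ≃ 0Z
  *-cancelʳ-≃0 w d d≄0 wd≃0 = cmpZ0≡eq⇒≃0 (trans (sym (cmpZ0-*-pos w (d *Z d) (0<² d d≄0))) (cmpZ0-resp {w *Z (d *Z d)} {0Z} wdd≃0))
    where
      wdd≃0 : w *Z (d *Z d) ≃ 0Z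
      wdd≃0 = ℤα.trans (ℤα.sym (ℤα.*-assoc w d d)) (ℤα.trans (ℤα.*-cong wd≃0 ℤα.refl) (ℤα.zeroˡ d))

  ≥Z⇒cmpZ≤ : ∀ {u v} → v ≥Z u → cmpZ u v ≢ gt
  ≥Z⇒cmpZ≤ {u₁ , u₂} {v₁ , v₂} h q = h (trans (cmpN-↭ {b = v₁ ++ u₂} (++-comm v₂ u₁) ↭-refl) q)

  cmpZ≤⇒≥Z : ∀ {u v} → cmpZ u v ≢ gt → v ≥Z u
  cmpZ≤⇒≥Z {u₁ , u₂} {v₁ , v₂} h q = h (trans (cmpN-↭ {b = v₁ ++ u₂} (++-comm u₁ v₂) ↭-refl) q)

  geZb≡true⇒≥Z : ∀ u v → geZb u v ≡ true → u ≥Z v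
  geZb≡true⇒≥Z (a₁ , a₂) (b₁ , b₂) h with cmpN (a₂ +N b₁) (a₁ +N b₂)
  ... | lt = λ ()
  ... | eq = λ ()

  geZb≡false⇒≱Z : ∀ u v → geZb u v ≡ false → ¬ u ≥Z v
  geZb≡false⇒≱Z (a₁ , a₂) (b₁ , b₂) h with cmpN (a₂ +N b₁) (a₁ +N b₂)
  ... | gt = λ k → k refl

module Fractions (α : Ordinal) where

  open import Data.Bool using (true; false)
  open import Data.Nat using (ℕ)
  open import Data.Product using (_×_; _,_; proj₁; proj₂)
  open import Function using (case_of_)
  open import Relation.Binary.PropositionalEquality
  open import Relation.Nullary using (¬_)

  open Integers α public
  open ZS using (_:+_; _:*_; :-_; _:=_; con)

  num den : Q → Z
  num = proj₁
  den = proj₂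

  Valid⇒≄0 : ∀ {x} → Valid x → ¬ den x ≃ 0Z
  Valid⇒≄0 v p = v (≃⇒≈Z p)

  ≄0⇒Valid : ∀ {x} → ¬ den x ≃ 0Z → Valid x
  ≄0⇒Valid v p = v (≈Z⇒≃ p)

  ≈Q⇒≃ : ∀ {x y} → x ≈Q y → num x *Z den y ≃ den x *Z num y
  ≈Q⇒≃ = ≈Z⇒≃

  ≃⇒≈Q : ∀ {x y} → num x *Z den y ≃ den x *Z num y → x ≈Q y
  ≃⇒≈Q = ≃⇒≈Z

  halfQ : Q → Q
  halfQ (n , d) = (n , d +Z d)

  Valid-0Q : Valid 0Q
  Valid-0Q h = case ↭⇒≈N (≃⇒↭ (≈Z⇒≃ {1Z} {0Z} h)) of λ ()

  Valid-+ : ∀ {x y} → Valid x → Valid y → Valid (x +Q y)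
  Valid-+ {x} {y} vx vy = ≄0⇒Valid {x +Q y} (*-≄0 (den x) (den y) (Valid⇒≄0 {x} vx) (Valid⇒≄0 {y} vy))

  Valid-sub : ∀ {x y} → Valid x → Valid y → Valid (x -Q y)
  Valid-sub {x} {y} = Valid-+ {x} { -Q y}

  Valid-half : ∀ {x} → Valid x → Valid (halfQ x)
  Valid-half {n , d} v = ≄0⇒Valid {n , d +Z d} λ d+d≃0 →
    *-≄0 d (1Z +Z 1Z) (Valid⇒≄0 {n , d} v) (λ { (mk≃ p) → case ↭⇒≈N p of λ () })
         (ℤα.trans (ZS.solve 1 (λ d → d :* (con 1Z :+ con 1Z) := d :+ d) ℤα.refl d) d+d≃0)

  -- Fraction identities are checked in ℤα by cross-multiplying: a fraction
  -- polynomial is a pair (numerator, denominator) of ring polynomials.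
  module FractionSolver where
    open ZS public using (Polynomial; _:+_; _:*_; :-_; _:=_; con)

    FP : ℕ → Set
    FP n = Polynomial n × Polynomial n

    infixl 6 _:+Q_ _:-Q_

    _:+Q_ : ∀ {n} → FP n → FP n → FP n
    (a , b) :+Q (c , d) = ((a :* d) :+ (c :* b) , b :* d)

    :-Q_ : ∀ {n} → FP n → FP n
    :-Q (a , b) = (:- a , b)

    _:-Q_ : ∀ {n} → FP n → FP n → FP n
    x :-Q y = x :+Q (:-Q y)

    :half : ∀ {n} → FP n → FP n
    :half (a , b) = (a , b :+ b)

    :0Q : ∀ {n} → FP n
    :0Q = (con 0Z , con 1Z)

    _:≈Q_ : ∀ {n} → FP n → FP n → Polynomial n × Polynomial n
    (a , b) :≈Q (c , d) = (a :* d) := (b :* c)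

  ≈Q-refl : ∀ {x} → x ≈Q x
  ≈Q-refl {n , d} = ≃⇒≈Q {n , d} {n , d} (ℤα.*-comm n d)

  ≈Q-sym : ∀ {x y} → x ≈Q y → y ≈Q x
  ≈Q-sym {a , b} {c , d} p = ≃⇒≈Q {c , d} {a , b}
    (ℤα.trans (ℤα.*-comm c b) (ℤα.trans (ℤα.sym (≈Q⇒≃ {a , b} {c , d} p)) (ℤα.*-comm a d)))

  -- From a d = b c and c f = d e, d (a f - b e) = f (a d - b c) + b (c f - d e) = 0;
  -- d ≠ 0 since the middle fraction is valid.
  ≈Q-trans : ∀ {x y z} → Valid y → x ≈Q y → y ≈Q z → x ≈Q z
  ≈Q-trans {a , b} {c , d} {e , f} vy p q =
    ≃⇒≈Q {a , b} {e , f} (x∙y⁻¹≈ε⇒x≈y _ _ (*-cancelʳ-≃0 _ d (Valid⇒≄0 {c , d} vy) key))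
    where
      open import Relation.Binary.Reasoning.Setoid ℤα.setoid
      key : ((a *Z f) +Z (-Z (b *Z e))) *Z d ≃ 0Z
      key = begin
        ((a *Z f) +Z (-Z (b *Z e))) *Z d
          ≈⟨ ZS.solve 6 (λ a b c d e f →
                ((a :* f) :+ (:- (b :* e))) :* d
                := (f :* ((a :* d) :+ (:- (b :* c))))
                      :+ (b :* ((c :* f) :+ (:- (d :* e)))))
               ℤα.refl a b c d e f ⟩
        (f *Z ((a *Z d) +Z (-Z (b *Z c)))) +Z (b *Z ((c *Z f) +Z (-Z (d *Z e))))
          ≈⟨ ℤα.+-cong (ℤα.*-cong (ℤα.refl {f}) (x≈y⇒x∙y⁻¹≈ε (≈Q⇒≃ {a , b} {c , d} p)))
                       (ℤα.*-cong (ℤα.refl {b}) (x≈y⇒x∙y⁻¹≈ε (≈Q⇒≃ {c , d} {e , f} q))) ⟩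
        (f *Z 0Z) +Z (b *Z 0Z)
          ≈⟨ ℤα.+-cong (ℤα.zeroʳ f) (ℤα.zeroʳ b) ⟩
        0Z +Z 0Z
          ≈⟨ ℤα.+-identityˡ 0Z ⟩
        0Z ∎

  -- sgnQ x compares 0 with x, so sgnQ x ≡ lt means x is positive.
  sgnQ : Q → Cmp
  sgnQ (n , d) = cmpZ 0Z (n *Z d)

  sgnQ-resp : ∀ {x y} → Valid x → Valid y → x ≈Q y → sgnQ x ≡ sgnQ y
  sgnQ-resp {n , d} {n′ , d′} vx vy p = begin
    cmpZ 0Z (n *Z d)                         ≡⟨ sym (cmpZ0-*-pos (n *Z d) (d′ *Z d′) (0<² d′ (Valid⇒≄0 {n′ , d′} vy))) ⟩
    cmpZ 0Z ((n *Z d) *Z (d′ *Z d′))         ≡⟨ cmpZ0-resp {(n *Z d) *Z (d′ *Z d′)} {(n′ *Z d′) *Z (d *Z d)} cross ⟩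
    cmpZ 0Z ((n′ *Z d′) *Z (d *Z d))         ≡⟨ cmpZ0-*-pos (n′ *Z d′) (d *Z d) (0<² d (Valid⇒≄0 {n , d} vx)) ⟩
    cmpZ 0Z (n′ *Z d′)                       ∎
    where
      open ≡-Reasoning
      cross : (n *Z d) *Z (d′ *Z d′) ≃ (n′ *Z d′) *Z (d *Z d)
      cross = ℤα.trans (ZS.solve 3 (λ n d d′ → (n :* d) :* (d′ :* d′) := (n :* d′) :* (d :* d′)) ℤα.refl n d d′)
             (ℤα.trans (ℤα.*-cong (≈Q⇒≃ {n , d} {n′ , d′} p) ℤα.refl)
                       (ZS.solve 3 (λ n′ d d′ → (d :* n′) :* (d :* d′) := (n′ :* d′) :* (d :* d)) ℤα.refl n′ d d′))

  sgnQ-neg : ∀ x → sgnQ (-Q x) ≡ flipCmp (sgnQ x)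
  sgnQ-neg (n , d) =
    trans (cmpZ0-resp {(-Z n) *Z d} { -Z (n *Z d)} (ZS.solve 2 (λ n d → (:- n) :* d := :- (n :* d)) ℤα.refl n d))
          (cmpZ0-neg (n *Z d))

  -- (a d + c b) b d = a b d² + c d b², and positive squares do not change signs.
  sgnQ-+ : ∀ x y → Valid x → Valid y → sgnQ x ≢ gt → sgnQ y ≢ gt → sgnQ (x +Q y) ≡ sgnQ x then sgnQ y
  sgnQ-+ (a , b) (c , d) vx vy hx hy =
    trans (cmpZ0-resp {((a *Z d) +Z (c *Z b)) *Z (b *Z d)} {((a *Z b) *Z (d *Z d)) +Z ((c *Z d) *Z (b *Z b))}
            (ZS.solve 4 (λ a b c d → ((a :* d) :+ (c :* b)) :* (b :* d)
                                      := ((a :* b) :* (d :* d)) :+ ((c :* d) :* (b :* b))) ℤα.refl a b c d))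
          (trans (cmpZ0-+ ((a *Z b) *Z (d *Z d)) ((c *Z d) *Z (b *Z b)) (λ q → hx (trans (sym e₁) q)) (λ q → hy (trans (sym e₂) q)))
                 (cong₂ _then_ e₁ e₂))
    where
      e₁ = cmpZ0-*-pos (a *Z b) (d *Z d) (0<² d (Valid⇒≄0 {c , d} vy))
      e₂ = cmpZ0-*-pos (c *Z d) (b *Z b) (0<² b (Valid⇒≄0 {a , b} vx))

  sgnQ-half : ∀ x → sgnQ (halfQ x) ≡ sgnQ x
  sgnQ-half (n , d) =
    trans (cmpZ0-resp {n *Z (d +Z d)} {(n *Z d) *Z (1Z +Z 1Z)}
            (ZS.solve 2 (λ n d → n :* (d :+ d) := (n :* d) :* (con 1Z :+ con 1Z)) ℤα.refl n d))
          (cmpZ0-*-pos (n *Z d) (1Z +Z 1Z) refl)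

  NonNeg⇒sgnQ≤ : ∀ x → NonNeg x → sgnQ x ≢ gt
  NonNeg⇒sgnQ≤ (n , d) = ≥Z⇒cmpZ≤ {0Z} {n *Z d}

  sgnQ≤⇒NonNeg : ∀ x → sgnQ x ≢ gt → NonNeg x
  sgnQ≤⇒NonNeg (n , d) = cmpZ≤⇒≥Z {0Z} {n *Z d}

  private
    num-sub : ∀ x y → num (y -Q x) ≃ (den x *Z num y) +Z (-Z (num x *Z den y))
    num-sub (n , d) (n′ , d′) =
      ZS.solve 4 (λ n d n′ d′ → (n′ :* d) :+ ((:- n) :* d′) := (d :* n′) :+ (:- (n :* d′)))
        ℤα.refl n d n′ d′

  ≈Q⇒sgnQ-sub≡eq : ∀ x y → x ≈Q y → sgnQ (y -Q x) ≡ eq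
  ≈Q⇒sgnQ-sub≡eq x y p = cmpZ0-resp {num (y -Q x) *Z den (y -Q x)} {0Z}
    (ℤα.trans (ℤα.*-cong (ℤα.trans (num-sub x y) (x≈y⇒x∙y⁻¹≈ε (ℤα.sym (≈Q⇒≃ {x} {y} p)))) ℤα.refl)
              (ℤα.zeroˡ (den (y -Q x))))

  sgnQ-sub≡eq⇒≈Q : ∀ x y → Valid x → Valid y → sgnQ (y -Q x) ≡ eq → x ≈Q y
  sgnQ-sub≡eq⇒≈Q x y vx vy h = ≃⇒≈Q {x} {y} (ℤα.sym (x∙y⁻¹≈ε⇒x≈y _ _
    (ℤα.trans (ℤα.sym (num-sub x y))
      (*-cancelʳ-≃0 (num (y -Q x)) (den (y -Q x)) (Valid⇒≄0 {y -Q x} (Valid-sub {y} {x} vy vx))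
                    (cmpZ0≡eq⇒≃0 {num (y -Q x) *Z den (y -Q x)} h)))))

  nonNegb≡true⇒NonNeg : ∀ x → nonNegb x ≡ true → NonNeg x
  nonNegb≡true⇒NonNeg (n , d) = geZb≡true⇒≥Z (n *Z d) 0Z

  nonNegb≡false⇒¬NonNeg : ∀ x → nonNegb x ≡ false → ¬ NonNeg x
  nonNegb≡false⇒¬NonNeg (n , d) = geZb≡false⇒≱Z (n *Z d) 0Z

module Rationals (α : Ordinal) where

  open import Data.Bool using (true; false)
  open import Data.Empty using (⊥-elim)
  open import Data.Product using (Σ; _×_; _,_; proj₁; proj₂)
  open import Function using (case_of_)
  open import Relation.Binary.PropositionalEquality
  open import Relation.Nullary using (¬_)

  open Fractions α public
  open FractionSolver

  ℚα : Set
  ℚα = Σ Q Valid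

  infixl 6 _+_ _-_
  infix 8 -_
  infix 4 _≋_

  _+_ : ℚα → ℚα → ℚα
  (x , vx) + (y , vy) = (x +Q y , Valid-+ {x} {y} vx vy)

  -_ : ℚα → ℚα
  - (x , vx) = (-Q x , vx)

  _-_ : ℚα → ℚα → ℚα
  x - y = x + (- y)

  half : ℚα → ℚα
  half (x , vx) = (halfQ x , Valid-half {x} vx)

  0ℚ : ℚα
  0ℚ = (0Q , Valid-0Q)

  record _≋_ (x y : ℚα) : Set where
    constructor mk≋
    field ≋⇒≈Q : proj₁ x ≈Q proj₁ y

  open _≋_ public

  ≋-refl : ∀ {x} → x ≋ x
  ≋-refl {x} = mk≋ (≈Q-refl {proj₁ x})

  ≋-sym : ∀ {x y} → x ≋ y → y ≋ x
  ≋-sym {x} {y} (mk≋ p) = mk≋ (≈Q-sym {proj₁ x} {proj₁ y} p)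

  ≋-trans : ∀ {x y z} → x ≋ y → y ≋ z → x ≋ z
  ≋-trans {x} {y} {z} (mk≋ p) (mk≋ q) = mk≋ (≈Q-trans {proj₁ x} {proj₁ y} {proj₁ z} (proj₂ y) p q)

  *-cross⇒≋ : ∀ x y → num (proj₁ x) *Z den (proj₁ y) ≃ den (proj₁ x) *Z num (proj₁ y) → x ≋ y
  *-cross⇒≋ x y p = mk≋ (≃⇒≈Q {proj₁ x} {proj₁ y} p)

  sub-flip : ∀ x y → x - y ≋ - (y - x)
  sub-flip x@((a , a′) , _) y@((b , b′) , _) = *-cross⇒≋ (x - y) (- (y - x))
    (ZS.solve 4 (λ a a′ b b′ → ((a , a′) :-Q (b , b′)) :≈Q (:-Q ((b , b′) :-Q (a , a′)))) ℤα.refl a a′ b b′)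

  sub-telescope : ∀ x y z → z - x ≋ (y - x) + (z - y)
  sub-telescope x@((a , a′) , _) y@((b , b′) , _) z@((c , c′) , _) = *-cross⇒≋ (z - x) ((y - x) + (z - y))
    (ZS.solve 6 (λ a a′ b b′ c c′ → let x = (a , a′) ; y = (b , b′) ; z = (c , c′) in
       (z :-Q x) :≈Q ((y :-Q x) :+Q (z :-Q y))) ℤα.refl a a′ b b′ c c′)

  sub-self : ∀ x → x - x ≋ 0ℚ
  sub-self x@((a , a′) , _) = *-cross⇒≋ (x - x) 0ℚ
    (ZS.solve 2 (λ a a′ → ((a , a′) :-Q (a , a′)) :≈Q :0Q) ℤα.refl a a′)

  sub-0 : ∀ x → x - 0ℚ ≋ x
  sub-0 x@((a , a′) , _) = *-cross⇒≋ (x - 0ℚ) x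
    (ZS.solve 2 (λ a a′ → ((a , a′) :-Q :0Q) :≈Q (a , a′)) ℤα.refl a a′)

  +-sub-+ʳ : ∀ x y z → (y + z) - (x + z) ≋ y - x
  +-sub-+ʳ x@((a , a′) , _) y@((b , b′) , _) z@((c , c′) , _) = *-cross⇒≋ ((y + z) - (x + z)) (y - x)
    (ZS.solve 6 (λ a a′ b b′ c c′ → let x = (a , a′) ; y = (b , b′) ; z = (c , c′) in
       ((y :+Q z) :-Q (x :+Q z)) :≈Q (y :-Q x)) ℤα.refl a a′ b b′ c c′)

  +-comm : ∀ x y → x + y ≋ y + x
  +-comm x@((a , a′) , _) y@((b , b′) , _) = *-cross⇒≋ (x + y) (y + x)
    (ZS.solve 4 (λ a a′ b b′ → ((a , a′) :+Q (b , b′)) :≈Q ((b , b′) :+Q (a , a′))) ℤα.refl a a′ b b′)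

  neg-sub-neg : ∀ x y → (- y) - (- x) ≋ x - y
  neg-sub-neg x@((a , a′) , _) y@((b , b′) , _) = *-cross⇒≋ ((- y) - (- x)) (x - y)
    (ZS.solve 4 (λ a a′ b b′ → ((:-Q (b , b′)) :-Q (:-Q (a , a′))) :≈Q ((a , a′) :-Q (b , b′))) ℤα.refl a a′ b b′)

  half+half : ∀ x → half x + half x ≋ x
  half+half x@((a , a′) , _) = *-cross⇒≋ (half x + half x) x
    (ZS.solve 2 (λ a a′ → (:half (a , a′) :+Q :half (a , a′)) :≈Q (a , a′)) ℤα.refl a a′)

  sub-sub : ∀ x r → x - (x - r) ≋ r
  sub-sub x@((a , a′) , _) r@((b , b′) , _) = *-cross⇒≋ (x - (x - r)) r
    (ZS.solve 4 (λ a a′ b b′ → ((a , a′) :-Q ((a , a′) :-Q (b , b′))) :≈Q (b , b′)) ℤα.refl a a′ b b′)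

  +-sub : ∀ x r → (x + r) - x ≋ r
  +-sub x@((a , a′) , _) r@((b , b′) , _) = *-cross⇒≋ ((x + r) - x) r
    (ZS.solve 4 (λ a a′ b b′ → (((a , a′) :+Q (b , b′)) :-Q (a , a′)) :≈Q (b , b′)) ℤα.refl a a′ b b′)

  +-sub-cancel : ∀ x y → x + (y - x) ≋ y
  +-sub-cancel x@((a , a′) , _) y@((b , b′) , _) = *-cross⇒≋ (x + (y - x)) y
    (ZS.solve 4 (λ a a′ b b′ → ((a , a′) :+Q ((b , b′) :-Q (a , a′))) :≈Q (b , b′)) ℤα.refl a a′ b b′)

  +-sub-sub : ∀ x r → (x + r) - (x - r) ≋ r + r
  +-sub-sub x@((a , a′) , _) r@((b , b′) , _) = *-cross⇒≋ ((x + r) - (x - r)) (r + r)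
    (ZS.solve 4 (λ a a′ b b′ → let x = (a , a′) ; r = (b , b′) in
       ((x :+Q r) :-Q (x :-Q r)) :≈Q (r :+Q r)) ℤα.refl a a′ b b′)

  sub-sub-sub : ∀ x y r → y - (x - r) ≋ r - (x - y)
  sub-sub-sub x@((a , a′) , _) y@((b , b′) , _) r@((c , c′) , _) = *-cross⇒≋ (y - (x - r)) (r - (x - y))
    (ZS.solve 6 (λ a a′ b b′ c c′ → let x = (a , a′) ; y = (b , b′) ; r = (c , c′) in
       (y :-Q (x :-Q r)) :≈Q (r :-Q (x :-Q y))) ℤα.refl a a′ b b′ c c′)

  +-sub-neg : ∀ x y r → (x + r) - y ≋ r - (- (x - y))
  +-sub-neg x@((a , a′) , _) y@((b , b′) , _) r@((c , c′) , _) = *-cross⇒≋ ((x + r) - y) (r - (- (x - y)))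
    (ZS.solve 6 (λ a a′ b b′ c c′ → let x = (a , a′) ; y = (b , b′) ; r = (c , c′) in
       ((x :+Q r) :-Q y) :≈Q (r :-Q (:-Q (x :-Q y)))) ℤα.refl a a′ b b′ c c′)

  sub-+-sub : ∀ a k t u → (a - u) + (k - (t - u)) ≋ (a + k) - t
  sub-+-sub a@((a₁ , a₂) , _) k@((k₁ , k₂) , _) t@((t₁ , t₂) , _) u@((u₁ , u₂) , _) =
    *-cross⇒≋ ((a - u) + (k - (t - u))) ((a + k) - t)
    (ZS.solve 8 (λ a₁ a₂ k₁ k₂ t₁ t₂ u₁ u₂ → let a = (a₁ , a₂) ; k = (k₁ , k₂) ; t = (t₁ , t₂) ; u = (u₁ , u₂) in
       ((a :-Q u) :+Q (k :-Q (t :-Q u))) :≈Q ((a :+Q k) :-Q t)) ℤα.refl a₁ a₂ k₁ k₂ t₁ t₂ u₁ u₂)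

  +-+-sub : ∀ b e t u → (b + u) + (e + (t - u)) ≋ (b + e) + t
  +-+-sub b@((b₁ , b₂) , _) e@((e₁ , e₂) , _) t@((t₁ , t₂) , _) u@((u₁ , u₂) , _) =
    *-cross⇒≋ ((b + u) + (e + (t - u))) ((b + e) + t)
    (ZS.solve 8 (λ b₁ b₂ e₁ e₂ t₁ t₂ u₁ u₂ → let b = (b₁ , b₂) ; e = (e₁ , e₂) ; t = (t₁ , t₂) ; u = (u₁ , u₂) in
       ((b :+Q u) :+Q (e :+Q (t :-Q u))) :≈Q ((b :+Q e) :+Q t)) ℤα.refl b₁ b₂ e₁ e₂ t₁ t₂ u₁ u₂)

  +-sub-+ : ∀ a b k e → (b + e) - (a + k) ≋ (b - a) + (e - k)
  +-sub-+ a@((a₁ , a₂) , _) b@((b₁ , b₂) , _) k@((k₁ , k₂) , _) e@((e₁ , e₂) , _) =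
    *-cross⇒≋ ((b + e) - (a + k)) ((b - a) + (e - k))
    (ZS.solve 8 (λ a₁ a₂ b₁ b₂ k₁ k₂ e₁ e₂ → let a = (a₁ , a₂) ; b = (b₁ , b₂) ; k = (k₁ , k₂) ; e = (e₁ , e₂) in
       ((b :+Q e) :-Q (a :+Q k)) :≈Q ((b :-Q a) :+Q (e :-Q k))) ℤα.refl a₁ a₂ b₁ b₂ k₁ k₂ e₁ e₂)

  sgn : ℚα → Cmp
  sgn x = sgnQ (proj₁ x)

  sgn-resp : ∀ {x y} → x ≋ y → sgn x ≡ sgn y
  sgn-resp {x} {y} (mk≋ p) = sgnQ-resp {proj₁ x} {proj₁ y} (proj₂ x) (proj₂ y) p

  -- Opaque, so that unification never unfolds a comparison into ℤα arithmetic.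
  opaque
    cmp : ℚα → ℚα → Cmp
    cmp x y = sgn (y - x)

    cmp-unfold : ∀ x y → cmp x y ≡ sgn (y - x)
    cmp-unfold x y = refl

  cmp-isComparison : IsComparison cmp
  cmp-isComparison = record
    { flip-cmp  = λ x y → begin
        cmp y x             ≡⟨ cmp-unfold y x ⟩
        sgn (x - y)         ≡⟨ sgn-resp (sub-flip x y) ⟩
        sgn (- (y - x))     ≡⟨ sgnQ-neg (proj₁ (y - x)) ⟩
        flipCmp (sgn (y - x)) ≡⟨ cong flipCmp (sym (cmp-unfold x y)) ⟩
        flipCmp (cmp x y)   ∎
    ; cmp-refl  = λ x → trans (cmp-unfold x x) (sgn-resp (sub-self x))
    ; cmp-trans = λ x y z x≤y y≤z → begin
        cmp x z                         ≡⟨ cmp-unfold x z ⟩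
        sgn (z - x)                     ≡⟨ sgn-resp (sub-telescope x y z) ⟩
        sgn ((y - x) + (z - y))         ≡⟨ sgnQ-+ (proj₁ (y - x)) (proj₁ (z - y)) (proj₂ (y - x)) (proj₂ (z - y))
                                                 (subst (_≢ gt) (cmp-unfold x y) x≤y) (subst (_≢ gt) (cmp-unfold y z) y≤z) ⟩
        sgn (y - x) then sgn (z - y)    ≡⟨ sym (cong₂ _then_ (cmp-unfold x y) (cmp-unfold y z)) ⟩
        cmp x y then cmp y z            ∎
    }
    where open ≡-Reasoning

  open IsComparison cmp-isComparison public
    using (_<_; _≤_; <⇒>; >⇒<; ≮⇒≥; <-≤-trans; ≤-<-trans; <-trans; ≤-trans; <-irrefl; ≤⊎>; <⊎≈⊎>)

  ≋⇒cmp≡eq : ∀ {x y} → x ≋ y → cmp x y ≡ eq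
  ≋⇒cmp≡eq {x} {y} (mk≋ p) = trans (cmp-unfold x y) (≈Q⇒sgnQ-sub≡eq (proj₁ x) (proj₁ y) p)

  cmp≡eq⇒≋ : ∀ {x y} → cmp x y ≡ eq → x ≋ y
  cmp≡eq⇒≋ {x} {y} h = mk≋ (sgnQ-sub≡eq⇒≈Q (proj₁ x) (proj₁ y) (proj₂ x) (proj₂ y) (trans (sym (cmp-unfold x y)) h))

  cmp-≋ˡ : ∀ {x x′} z → x ≋ x′ → cmp x z ≡ cmp x′ z
  cmp-≋ˡ z p = IsComparison.≈-respˡ cmp-isComparison z (≋⇒cmp≡eq p)

  cmp-≋ʳ : ∀ z {x x′} → x ≋ x′ → cmp z x ≡ cmp z x′
  cmp-≋ʳ z p = IsComparison.≈-respʳ cmp-isComparison z (≋⇒cmp≡eq p)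

  cmp0 : ∀ x → cmp 0ℚ x ≡ sgn x
  cmp0 x = trans (cmp-unfold 0ℚ x) (sgn-resp (sub-0 x))

  cmp-diff : ∀ x y → cmp x y ≡ cmp 0ℚ (y - x)
  cmp-diff x y = trans (cmp-unfold x y) (sym (cmp0 (y - x)))

  cmp-by-diff : ∀ {a b a′ b′} → b - a ≋ b′ - a′ → cmp a b ≡ cmp a′ b′
  cmp-by-diff {a} {b} {a′} {b′} p = trans (cmp-diff a b) (trans (cmp-≋ʳ 0ℚ p) (sym (cmp-diff a′ b′)))

  cmp-+ʳ : ∀ x y z → cmp (x + z) (y + z) ≡ cmp x y
  cmp-+ʳ x y z = cmp-by-diff (+-sub-+ʳ x y z)

  cmp-+ˡ : ∀ x y z → cmp (z + x) (z + y) ≡ cmp x y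
  cmp-+ˡ x y z = trans (cmp-≋ˡ (z + y) (+-comm z x)) (trans (cmp-≋ʳ (x + z) (+-comm z y)) (cmp-+ʳ x y z))

  cmp-neg : ∀ x y → cmp (- x) (- y) ≡ cmp y x
  cmp-neg x y = cmp-by-diff (neg-sub-neg x y)

  cmp-sub-swap : ∀ t u v → cmp (t - u) (t - v) ≡ cmp v u
  cmp-sub-swap t u v = trans (cmp-+ˡ (- u) (- v) t) (cmp-neg u v)

  cmp0-half : ∀ x → cmp 0ℚ (half x) ≡ cmp 0ℚ x
  cmp0-half x = trans (cmp0 (half x)) (trans (sgnQ-half (proj₁ x)) (sym (cmp0 x)))

  +-mono-< : ∀ {x y u v} → x < y → u < v → x + u < y + v
  +-mono-< {x} {y} {u} {v} x<y u<v =
    <-≤-trans (trans (cmp-+ʳ x y u) x<y) (≡lt⇒≢gt (trans (cmp-+ˡ u v y) u<v))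

  +-mono-≤ : ∀ {x y u v} → x ≤ y → u ≤ v → x + u ≤ y + v
  +-mono-≤ {x} {y} {u} {v} x≤y u≤v =
    ≤-trans (λ q → x≤y (trans (sym (cmp-+ʳ x y u)) q)) (λ q → u≤v (trans (sym (cmp-+ˡ u v y)) q))

  <Q⇒< : ∀ {x y} → proj₁ x <Q proj₁ y → x < y
  <Q⇒< {x} {y} (x≤y , x≉y) with cmp x y in e
  ... | lt = refl
  ... | eq = ⊥-elim (x≉y (≋⇒≈Q (cmp≡eq⇒≋ e)))
  ... | gt = ⊥-elim (NonNeg⇒sgnQ≤ (proj₁ (y - x)) x≤y (trans (sym (cmp-unfold x y)) e))

  <⇒<Q : ∀ {x y} → x < y → proj₁ x <Q proj₁ y
  <⇒<Q {x} {y} x<y =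
    sgnQ≤⇒NonNeg (proj₁ (y - x)) (λ q → ≡lt⇒≢gt x<y (trans (cmp-unfold x y) q)) ,
    λ p → case trans (sym x<y) (≋⇒cmp≡eq (mk≋ p)) of λ ()

  ≤Q⇒≤ : ∀ {x y} → proj₁ x ≤Q proj₁ y → x ≤ y
  ≤Q⇒≤ {x} {y} h q = NonNeg⇒sgnQ≤ (proj₁ (y - x)) h (trans (sym (cmp-unfold x y)) q)

  ≤⇒≤Q : ∀ {x y} → x ≤ y → proj₁ x ≤Q proj₁ y
  ≤⇒≤Q {x} {y} h = sgnQ≤⇒NonNeg (proj₁ (y - x)) (λ q → h (trans (cmp-unfold x y) q))

  Positive⇒0< : ∀ {r} → Positive (proj₁ r) → 0ℚ < r
  Positive⇒0< (_ , 0<r) = <Q⇒< 0<r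

  -- - 0ℚ reduces to 0ℚ, so cmp-neg also relates comparisons with 0ℚ.
  neg-≤0 : ∀ {z} → 0ℚ ≤ z → - z ≤ 0ℚ
  neg-≤0 {z} h q = h (trans (sym (cmp-neg z 0ℚ)) q)

  neg-0< : ∀ {z} → z < 0ℚ → 0ℚ < - z
  neg-0< {z} h = trans (cmp-neg 0ℚ z) h

  abs<⇒ : ∀ z r → absQ (proj₁ z) <Q proj₁ r → z < r × - z < r
  abs<⇒ z r h with nonNegb (proj₁ z) in e
  ... | true  = z<r , ≤-<-trans (≤-trans (neg-≤0 0≤z) 0≤z) z<r
    where
      z<r = <Q⇒< {z} {r} h
      0≤z : 0ℚ ≤ z
      0≤z q = NonNeg⇒sgnQ≤ (proj₁ z) (nonNegb≡true⇒NonNeg (proj₁ z) e) (trans (sym (cmp0 z)) q)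
  ... | false = <-trans (<-trans z<0 (neg-0< z<0)) -z<r , -z<r
    where
      -z<r = <Q⇒< { - z} {r} h
      z<0 : z < 0ℚ
      z<0 = >⇒< (trans (cmp0 z) (¬≢gt⇒≡gt λ q → nonNegb≡false⇒¬NonNeg (proj₁ z) e (sgnQ≤⇒NonNeg (proj₁ z) q)))

  ⇒abs< : ∀ z r → z < r → - z < r → absQ (proj₁ z) <Q proj₁ r
  ⇒abs< z r z<r -z<r with nonNegb (proj₁ z)
  ... | true  = <⇒<Q z<r
  ... | false = <⇒<Q -z<r

module Balls (α : Ordinal) where

  open import Data.Empty using (⊥)
  open import Data.Product using (_×_; _,_; proj₁; proj₂)
  open import Data.Sum using ([_,_])
  open import Relation.Binary.PropositionalEquality using (sym; trans)

  open Rationals α public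

  0<-diff : ∀ {a b} → a < b → 0ℚ < b - a
  0<-diff {a} {b} a<b = trans (sym (cmp-diff a b)) a<b

  sub<self : ∀ x {r} → 0ℚ < r → x - r < x
  sub<self x {r} 0<r = trans (cmp-diff (x - r) x) (trans (cmp-≋ʳ 0ℚ (sub-sub x r)) 0<r)

  self<+ : ∀ x {r} → 0ℚ < r → x < x + r
  self<+ x {r} 0<r = trans (cmp-diff x (x + r)) (trans (cmp-≋ʳ 0ℚ (+-sub x r)) 0<r)

  0<half : ∀ {d} → 0ℚ < d → 0ℚ < half d
  0<half {d} 0<d = trans (cmp0-half d) 0<d

  -- half d + 0 < half d + half d, where - 0ℚ reduces to 0ℚ.
  half<self : ∀ {d} → 0ℚ < d → half d < d
  half<self {d} 0<d =
    trans (cmp-≋ˡ d (≋-sym (sub-0 (half d))))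
          (trans (cmp-≋ʳ (half d + 0ℚ) (≋-sym (half+half d)))
                 (trans (cmp-+ˡ 0ℚ (half d) (half d)) (0<half 0<d)))

  +-<-half : ∀ {u v h} → u < half h → v < half h → u + v < h
  +-<-half {u} {v} {h} u<h/2 v<h/2 = trans (cmp-≋ʳ (u + v) (≋-sym (half+half h))) (+-mono-< u<h/2 v<h/2)

  midpoint : ℚα → ℚα → ℚα
  midpoint a b = a + half (b - a)

  <midpoint : ∀ {a b} → a < b → a < midpoint a b
  <midpoint {a} a<b = self<+ a (0<half (0<-diff a<b))

  midpoint< : ∀ {a b} → a < b → midpoint a b < b
  midpoint< {a} {b} a<b =
    trans (cmp-≋ʳ (midpoint a b) (≋-sym (+-sub-cancel a b)))
          (trans (cmp-+ˡ (half (b - a)) (b - a) a) (half<self (0<-diff a<b)))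

  ball⇒ : ∀ x r y → Ball (proj₁ x) (proj₁ r) (proj₁ y) → x - r < y × y < x + r
  ball⇒ x r y (_ , h) = trans (cmp-by-diff (sub-sub-sub x y r)) (proj₁ bounds)
                      , trans (cmp-by-diff (+-sub-neg x y r)) (proj₂ bounds)
    where bounds = abs<⇒ (x - y) r h

  ⇒ball : ∀ x r y → x - r < y → y < x + r → Ball (proj₁ x) (proj₁ r) (proj₁ y)
  ⇒ball x r y h₁ h₂ = proj₂ y , ⇒abs< (x - y) r (trans (sym (cmp-by-diff (sub-sub-sub x y r))) h₁)
                                                 (trans (sym (cmp-by-diff (+-sub-neg x y r))) h₂)

  center∈ball : ∀ x {r} → 0ℚ < r → Ball (proj₁ x) (proj₁ r) (proj₁ x)
  center∈ball x {r} 0<r = ⇒ball x r x (sub<self x 0<r) (self<+ x 0<r)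

  module _ (x r : ℚα) (0<r : 0ℚ < r) where

    private
      B = Ball (proj₁ x) (proj₁ r)

    ball-sup : IsSup B (proj₁ (x + r))
    ball-sup = proj₂ (x + r) , upper , least
      where
        upper : IsUpperBound B (proj₁ (x + r))
        upper y vy y∈B = ≤⇒≤Q {y , vy} {x + r} (≡lt⇒≢gt (proj₂ (ball⇒ x r (y , vy) y∈B)))

        least : ∀ u → Valid u → IsUpperBound B u → proj₁ (x + r) ≤Q u
        least u vu ub = ≤⇒≤Q {x + r} {U} λ x+r>U → gap (>⇒< x+r>U)
          where
            U = (u , vu)
            ≤U : ∀ w → B (proj₁ w) → w ≤ U
            ≤U w w∈B = ≤Q⇒≤ {w} {U} (ub (proj₁ w) (proj₂ w) w∈B)

            -- the midpoint of U and x + r lies in the ball above U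
            above : U < x + r → x ≤ U → ⊥
            above U<x+r x≤U = ≤U w w∈B (<⇒> (<midpoint U<x+r))
              where
                w = midpoint U (x + r)
                w∈B = ⇒ball x r w (<-≤-trans (sub<self x 0<r) (≤-trans x≤U (≡lt⇒≢gt (<midpoint U<x+r))))
                                  (midpoint< U<x+r)

            gap : U < x + r → ⊥
            gap U<x+r = [ above U<x+r , (λ U<x → ≤U x (center∈ball x 0<r) (<⇒> U<x)) ] (≤⊎> x U)

    ball-inf : IsInf B (proj₁ (x - r))
    ball-inf = proj₂ (x - r) , lower , greatest
      where
        lower : IsLowerBound B (proj₁ (x - r))
        lower y vy y∈B = ≤⇒≤Q {x - r} {y , vy} (≡lt⇒≢gt (proj₁ (ball⇒ x r (y , vy) y∈B)))

        greatest : ∀ u → Valid u → IsLowerBound B u → u ≤Q proj₁ (x - r)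
        greatest u vu lb = ≤⇒≤Q {U} {x - r} λ U>x-r → gap (>⇒< U>x-r)
          where
            U = (u , vu)
            U≤ : ∀ w → B (proj₁ w) → U ≤ w
            U≤ w w∈B = ≤Q⇒≤ {U} {w} (lb (proj₁ w) (proj₂ w) w∈B)

            below : x - r < U → U ≤ x → ⊥
            below x-r<U U≤x = U≤ w w∈B (<⇒> (midpoint< x-r<U))
              where
                w = midpoint (x - r) U
                w∈B = ⇒ball x r w (<midpoint x-r<U)
                                  (<-trans (<-≤-trans (midpoint< x-r<U) U≤x) (self<+ x 0<r))

            gap : x - r < U → ⊥
            gap x-r<U = [ below x-r<U , (λ x<U → U≤ x (center∈ball x 0<r) (<⇒> x<U)) ] (≤⊎> U x)

    <⇒ball-diam> : ∀ d → d < r + r → DiamGt B (proj₁ d)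
    <⇒ball-diam> d d<2r = proj₁ (x + r) , proj₁ (x - r) , ball-sup , ball-inf
                        , <⇒<Q {d} {(x + r) - (x - r)} (trans (cmp-≋ʳ d (+-sub-sub x r)) d<2r)

    ball-diam>⇒< : ∀ d → DiamGt B (proj₁ d) → d < r + r
    ball-diam>⇒< d (s , i , (vs , _ , s-least) , (vi , _ , i-greatest) , d<s-i) =
      trans (sym (cmp-≋ʳ d (+-sub-sub x r)))
            (<-≤-trans (<Q⇒< {d} {S - I} d<s-i) (+-mono-≤ s≤x+r (λ q → x-r≤i (trans (sym (cmp-neg I (x - r))) q))))
      where
        S = (s , vs)
        I = (i , vi)
        s≤x+r : S ≤ x + r
        s≤x+r = ≤Q⇒≤ {S} {x + r} (s-least (proj₁ (x + r)) (proj₂ (x + r)) (proj₁ (proj₂ ball-sup)))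
        x-r≤i : x - r ≤ I
        x-r≤i = ≤Q⇒≤ {x - r} {I} (i-greatest (proj₁ (x - r)) (proj₂ (x - r)) (proj₁ (proj₂ ball-inf)))

module CutSum (α : Ordinal) where

  open import Data.Empty using (⊥; ⊥-elim)
  open import Data.Product using (Σ; ∃; _×_; _,_; proj₁; proj₂)
  open import Data.Sum using (_⊎_; inj₁; inj₂; [_,_])
  open import Function using (case_of_)
  open import Relation.Binary.PropositionalEquality using (_≡_; _≢_; sym; trans)
  open import Relation.Nullary using (¬_)

  open Balls α

  pigeonhole₃ : ∀ {I : Set} {_≈_ : I → I → Set} (P Q : I → Set) →
                (∀ {u v} → ¬ P u → ¬ P v → u ≈ v) → (∀ {u v} → ¬ Q u → ¬ Q v → u ≈ v) →
                ∀ {u₁ u₂ u₃} → ¬ u₁ ≈ u₂ → ¬ u₁ ≈ u₃ → ¬ u₂ ≈ u₃ → ¬ ¬ (∃ λ u → P u × Q u)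
  pigeonhole₃ P Q P-fails-once Q-fails-once {u₁} {u₂} {u₃} u₁≉u₂ u₁≉u₃ u₂≉u₃ none =
    fails u₁ λ f₁ → fails u₂ λ f₂ → fails u₃ λ f₃ → clash f₁ f₂ f₃
    where
      fails : ∀ u → ¬ ¬ (¬ P u ⊎ ¬ Q u)
      fails u k = k (inj₁ λ p → k (inj₂ λ q → none (u , p , q)))

      clash : ¬ P u₁ ⊎ ¬ Q u₁ → ¬ P u₂ ⊎ ¬ Q u₂ → ¬ P u₃ ⊎ ¬ Q u₃ → ⊥
      clash (inj₁ f₁) (inj₁ f₂) _         = u₁≉u₂ (P-fails-once f₁ f₂)
      clash (inj₂ f₁) (inj₂ f₂) _         = u₁≉u₂ (Q-fails-once f₁ f₂)
      clash (inj₁ f₁) (inj₂ _)  (inj₁ f₃) = u₁≉u₃ (P-fails-once f₁ f₃)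
      clash (inj₁ _)  (inj₂ f₂) (inj₂ f₃) = u₂≉u₃ (Q-fails-once f₂ f₃)
      clash (inj₂ f₁) (inj₁ _)  (inj₂ f₃) = u₁≉u₃ (Q-fails-once f₁ f₃)
      clash (inj₂ _)  (inj₁ f₂) (inj₁ f₃) = u₂≉u₃ (P-fails-once f₂ f₃)

  _∈_ : ℚα → SubQ → Set
  x ∈ X = X (proj₁ x)

  _∉_ : ℚα → SubQ → Set
  x ∉ X = ¬ x ∈ X

  ∈⊕ : ∀ {X Y : SubQ} {x y} z → x ∈ X → y ∈ Y → z ≋ x + y → z ∈ (X ⊕ Y)
  ∈⊕ {x = x} {y} z x∈X y∈Y (mk≋ p) = proj₂ z , proj₁ x , proj₁ y , x∈X , y∈Y , p

  ⊕-isSubset : ∀ X Y → IsSubset (X ⊕ Y)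
  ⊕-isSubset X Y = (λ _ z∈ → proj₁ z∈) , ⊕-resp
    where
      ⊕-resp : ∀ x y → Valid y → x ≈Q y → (X ⊕ Y) x → (X ⊕ Y) y
      ⊕-resp x y vy x≈y (vx , a , k , a∈X , k∈Y , x≈a+k) =
        vy , a , k , a∈X , k∈Y , ≈Q-trans {y} {x} {a +Q k} vx (≈Q-sym {x} {y} x≈y) x≈a+k

  max⇒sup : ∀ {X : SubQ} {a} → a ∈ X → IsUpperBound X (proj₁ a) → IsSup X (proj₁ a)
  max⇒sup {a = a} a∈X ub = proj₂ a , ub , λ u _ ub-u → ub-u (proj₁ a) (proj₂ a) a∈X

  min⇒inf : ∀ {X : SubQ} {b} → b ∈ X → IsLowerBound X (proj₁ b) → IsInf X (proj₁ b)
  min⇒inf {b = b} b∈X lb = proj₂ b , lb , λ u _ lb-u → lb-u (proj₁ b) (proj₂ b) b∈X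

  module CutProperties {A B : SubQ} (cut : IsCut A B) where
    open IsCut cut using (subA; subB; gapAtMost1)

    A-valid : ∀ {a} → A a → Valid a
    A-valid = proj₁ subA _

    B-valid : ∀ {b} → B b → Valid b
    B-valid = proj₁ subB _

    A<B : ∀ {a b} → a ∈ A → b ∈ B → a < b
    A<B {a} {b} a∈A b∈B = <Q⇒< {a} {b} (IsCut.A<B cut (proj₁ a) (proj₁ b) a∈A b∈B)

    -- Points below a member of A cannot be in B, so those missing from A lie in
    -- the gap, which has at most one point.
    A-fails-once-below : ∀ {a u v} → a ∈ A → 0ℚ < u → 0ℚ < v →
                         (a - u) ∉ A → (a - v) ∉ A → cmp u v ≡ eq
    A-fails-once-below {a} {u} {v} a∈A 0<u 0<v a-u∉A a-v∉A =
      flip-≡ (trans (sym (cmp-sub-swap a u v))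
                    (≋⇒cmp≡eq (mk≋ (gapAtMost1 _ _ (proj₂ (a - u)) (proj₂ (a - v))
                                      a-u∉A (not-B 0<u) a-v∉A (not-B 0<v)))))
      where
        open IsComparison cmp-isComparison using (flip-≡)
        not-B : ∀ {w} → 0ℚ < w → (a - w) ∉ B
        not-B {w} 0<w a-w∈B = case trans (sym (A<B {a} {a - w} a∈A a-w∈B)) (<⇒> (sub<self a 0<w)) of λ ()

    B-fails-once-above : ∀ {b u v} → b ∈ B → 0ℚ < u → 0ℚ < v →
                         (b + u) ∉ B → (b + v) ∉ B → cmp u v ≡ eq
    B-fails-once-above {b} {u} {v} b∈B 0<u 0<v b+u∉B b+v∉B =
      trans (sym (cmp-+ˡ u v b))
            (≋⇒cmp≡eq (mk≋ (gapAtMost1 _ _ (proj₂ (b + u)) (proj₂ (b + v))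
                              (not-A 0<u) b+u∉B (not-A 0<v) b+v∉B)))
      where
        not-A : ∀ {w} → 0ℚ < w → (b + w) ∉ A
        not-A {w} 0<w b+w∈A = case trans (sym (A<B {b + w} {b} b+w∈A b∈B)) (<⇒> (self<+ b 0<w)) of λ ()

    -- If no pair a ∈ A, b ∈ B were δ-close, every ball meeting A and B would
    -- have diameter > δ, i.e. the cut would be improper.
    proper⇒close : Proper A B → ∀ δ → 0ℚ < δ →
                   ¬ ¬ (∃ λ a → ∃ λ b → a ∈ A × b ∈ B × b - a < δ)
    proper⇒close proper δ 0<δ far = proper (proj₁ δ , (proj₂ δ , <⇒<Q {0ℚ} {δ} 0<δ) , wide)
      where
        wide : ∀ x r → Valid x → Positive r → Meets (Ball x r) A → Meets (Ball x r) B → DiamGt (Ball x r) (proj₁ δ)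
        wide x r vx pos (y₁ , y₁∈ball , y₁∈A) (y₂ , y₂∈ball , y₂∈B) =
          <⇒ball-diam> X R 0<r δ (≤-<-trans δ≤Y₂-Y₁ Y₂-Y₁<2r)
          where
            X = (x , vx)
            R = (r , proj₁ pos)
            0<r = Positive⇒0< {R} pos
            Y₁ = (y₁ , proj₁ y₁∈ball)
            Y₂ = (y₂ , proj₁ y₂∈ball)
            δ≤Y₂-Y₁ : δ ≤ Y₂ - Y₁
            δ≤Y₂-Y₁ = ≮⇒≥ λ close → far (Y₁ , Y₂ , y₁∈A , y₂∈B , close)
            Y₂-Y₁<2r : Y₂ - Y₁ < R + R
            Y₂-Y₁<2r = trans (sym (cmp-≋ʳ (Y₂ - Y₁) (+-sub-sub X R)))
              (+-mono-< (proj₂ (ball⇒ X R Y₂ y₂∈ball)) (trans (cmp-neg Y₁ (X - R)) (proj₁ (ball⇒ X R Y₁ y₁∈ball))))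

  Between : ℚα → Set
  Between t = Σ ℚα λ u → 0ℚ < u × u < t

  -- The three distinct points t/2, t/4, t/8 of (0, t) suffice.
  pigeonhole-between : ∀ {t} → 0ℚ < t → (P Q : Between t → Set) →
                       (∀ {u v} → ¬ P u → ¬ P v → cmp (proj₁ u) (proj₁ v) ≡ eq) →
                       (∀ {u v} → ¬ Q u → ¬ Q v → cmp (proj₁ u) (proj₁ v) ≡ eq) →
                       ¬ ¬ (∃ λ u → P u × Q u)
  pigeonhole-between {t} 0<t P Q P-once Q-once =
    pigeonhole₃ {_≈_ = λ u v → cmp (proj₁ u) (proj₁ v) ≡ eq} P Q P-once Q-once
      {t₁ , 0<t₁ , t₁<t} {t₂ , 0<t₂ , t₂<t} {t₃ , 0<t₃ , t₃<t}
      (≉ t₂<t₁) (≉ (<-trans t₃<t₂ t₂<t₁)) (≉ t₃<t₂)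
    where
      t₁ = half t
      t₂ = half t₁
      t₃ = half t₂
      0<t₁ = 0<half 0<t
      0<t₂ = 0<half 0<t₁
      0<t₃ = 0<half 0<t₂
      t₁<t = half<self 0<t
      t₂<t₁ = half<self 0<t₁
      t₃<t₂ = half<self 0<t₂
      t₂<t = <-trans t₂<t₁ t₁<t
      t₃<t = <-trans t₃<t₂ t₂<t
      ≉ : ∀ {x y} → y < x → cmp x y ≢ eq
      ≉ y<x x≈y = case trans (sym (<⇒> y<x)) x≈y of λ ()

  module SumOfCuts {A B C D : SubQ} (cutAB : IsCut A B) (cutCD : IsCut C D) where
    private
      module AB = CutProperties cutAB
      module CD = CutProperties cutCD

    -- z = (a - u) + (k - (t - u)) with t = a + k - z; at most one u in (0, t)
    -- puts a - u outside A, and at most one puts k - (t - u) outside C.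
    ⊕-below-∈ : ∀ {a k z} → a ∈ A → k ∈ C → z < a + k → ¬ ¬ z ∈ (A ⊕ C)
    ⊕-below-∈ {a} {k} {z} a∈A k∈C z<a+k z∉ =
      pigeonhole-between (0<-diff z<a+k) A-ok C-ok
        (λ {(u , 0<u , _)} {(v , 0<v , _)} → AB.A-fails-once-below {a} a∈A 0<u 0<v)
        (λ {(u , _ , u<t)} {(v , _ , v<t)} f g →
           flip-≡ (trans (sym (cmp-sub-swap t u v)) (CD.A-fails-once-below {k} k∈C (0<-diff u<t) (0<-diff v<t) f g)))
        λ { ((u , _) , a-u∈A , k-[t-u]∈C) →
            z∉ (∈⊕ {x = a - u} {k - (t - u)} z a-u∈A k-[t-u]∈C (≋-sym (≋-trans (sub-+-sub a k t u) (sub-sub (a + k) z)))) }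
      where
        open IsComparison cmp-isComparison using (flip-≡)
        t = (a + k) - z
        A-ok C-ok : Between t → Set
        A-ok (u , _) = (a - u) ∈ A
        C-ok (u , _) = (k - (t - u)) ∈ C

    ⊕-above-∈ : ∀ {b e z} → b ∈ B → e ∈ D → b + e < z → ¬ ¬ z ∈ (B ⊕ D)
    ⊕-above-∈ {b} {e} {z} b∈B e∈D b+e<z z∉ =
      pigeonhole-between (0<-diff b+e<z) B-ok D-ok
        (λ {(u , 0<u , _)} {(v , 0<v , _)} → AB.B-fails-once-above {b} b∈B 0<u 0<v)
        (λ {(u , _ , u<t)} {(v , _ , v<t)} f g →
           flip-≡ (trans (sym (cmp-sub-swap t u v)) (CD.B-fails-once-above {e} e∈D (0<-diff u<t) (0<-diff v<t) f g)))
        λ { ((u , _) , b+u∈B , e+[t-u]∈D) →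
            z∉ (∈⊕ {x = b + u} {e + (t - u)} z b+u∈B e+[t-u]∈D (≋-sym (≋-trans (+-+-sub b e t u) (+-sub-cancel (b + e) z)))) }
      where
        open IsComparison cmp-isComparison using (flip-≡)
        t = z - (b + e)
        B-ok D-ok : Between t → Set
        B-ok (u , _) = (b + u) ∈ B
        D-ok (u , _) = (e + (t - u)) ∈ D

    ⊕-< : ∀ p q → (A ⊕ C) p → (B ⊕ D) q → p <Q q
    ⊕-< p q (vp , a , k , a∈A , k∈C , p≈a+k) (vq , b , e , b∈B , e∈D , q≈b+e) =
      <⇒<Q {p , vp} {q , vq}
        (trans (cmp-≋ˡ (q , vq) (mk≋ {p , vp} {a′ + k′} p≈a+k))
        (trans (cmp-≋ʳ (a′ + k′) (mk≋ {q , vq} {b′ + e′} q≈b+e))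
               (+-mono-< (AB.A<B {a′} {b′} a∈A b∈B) (CD.A<B {k′} {e′} k∈C e∈D))))
      where
        a′ k′ b′ e′ : ℚα
        a′ = (a , AB.A-valid a∈A)
        k′ = (k , CD.A-valid k∈C)
        b′ = (b , AB.B-valid b∈B)
        e′ = (e , CD.B-valid e∈D)

    ⊕-disjoint : ∀ z → (A ⊕ C) z → (B ⊕ D) z → ⊥
    ⊕-disjoint z z∈AC z∈BD = proj₂ (⊕-< z z z∈AC z∈BD) (≈Q-refl {z})

    -- A maximum of A ⊕ C, written a + k, would make a a maximum of A.
    ⊕-sup∉ : ∀ s → IsSup (A ⊕ C) s → ¬ (A ⊕ C) s
    ⊕-sup∉ s (_ , s-ub , _) (vs , a , k , a∈A , k∈C , s≈a+k) =
      IsCut.supA∉A cutAB a (max⇒sup {A} {a′} a∈A a-max) a∈A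
      where
        a′ k′ : ℚα
        a′ = (a , AB.A-valid a∈A)
        k′ = (k , CD.A-valid k∈C)
        a-max : IsUpperBound A a
        a-max x vx x∈A = ≤⇒≤Q {x , vx} {a′} λ x>a → x+k≤s
          (trans (cmp-≋ʳ ((x , vx) + k′) (mk≋ {s , vs} {a′ + k′} s≈a+k)) (trans (cmp-+ʳ (x , vx) a′ k′) x>a))
          where
            x+k≤s : (x , vx) + k′ ≤ (s , vs)
            x+k≤s = ≤Q⇒≤ {(x , vx) + k′} {s , vs}
                      (s-ub (proj₁ ((x , vx) + k′)) (proj₂ ((x , vx) + k′)) (∈⊕ {x = x , vx} {k′} ((x , vx) + k′) x∈A k∈C ≋-refl))

    ⊕-inf∉ : ∀ s → IsInf (B ⊕ D) s → ¬ (B ⊕ D) s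
    ⊕-inf∉ s (_ , s-lb , _) (vs , b , e , b∈B , e∈D , s≈b+e) =
      IsCut.infB∉B cutAB b (min⇒inf {B} {b′} b∈B b-min) b∈B
      where
        b′ e′ : ℚα
        b′ = (b , AB.B-valid b∈B)
        e′ = (e , CD.B-valid e∈D)
        b-min : IsLowerBound B b
        b-min x vx x∈B = ≤⇒≤Q {b′} {x , vx} λ b>x → s≤x+e
          (trans (cmp-≋ˡ ((x , vx) + e′) (mk≋ {s , vs} {b′ + e′} s≈b+e)) (trans (cmp-+ʳ b′ (x , vx) e′) b>x))
          where
            s≤x+e : (s , vs) ≤ (x , vx) + e′
            s≤x+e = ≤Q⇒≤ {s , vs} {(x , vx) + e′}
                      (s-lb (proj₁ ((x , vx) + e′)) (proj₂ ((x , vx) + e′)) (∈⊕ {x = x , vx} {e′} ((x , vx) + e′) x∈B e∈D ≋-refl))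

    module _ (properAB : Proper A B) (properCD : Proper C D) where

      -- With δ = (y - x)/2 and δ-close pairs a, b and k, e, the gap [x, y] of the
      -- sum fits inside [a + k, b + e], whose length is below 2δ = y - x.
      ⊕-no-gap : ∀ {x y} → x < y → x ∉ (A ⊕ C) → y ∉ (B ⊕ D) → ⊥
      ⊕-no-gap {x} {y} x<y x∉ y∉ =
        AB.proper⇒close properAB δ 0<δ λ { (a , b , a∈A , b∈B , b-a<δ) →
        CD.proper⇒close properCD δ 0<δ λ { (k , e , k∈C , e∈D , e-k<δ) →
          let a+k≤x : a + k ≤ x
              a+k≤x = ≮⇒≥ λ x<a+k → ⊕-below-∈ {a} {k} a∈A k∈C x<a+k x∉
              y≤b+e : y ≤ b + e
              y≤b+e = ≮⇒≥ λ b+e<y → ⊕-above-∈ {b} {e} b∈B e∈D b+e<y y∉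
              y-x≤ : y - x ≤ (b + e) - (a + k)
              y-x≤ = +-mono-≤ y≤b+e (λ q → a+k≤x (trans (sym (cmp-neg x (a + k))) q))
              y-x<y-x : y - x < y - x
              y-x<y-x = ≤-<-trans y-x≤ (trans (cmp-≋ˡ (y - x) (+-sub-+ a b k e)) (+-<-half b-a<δ e-k<δ))
          in <-irrefl y-x<y-x } }
        where
          δ = half (y - x)
          0<δ = 0<half (0<-diff x<y)

      ⊕-gapAtMost1 : ∀ x y → Valid x → Valid y → ¬ (A ⊕ C) x → ¬ (B ⊕ D) x → ¬ (A ⊕ C) y → ¬ (B ⊕ D) y → x ≈Q y
      ⊕-gapAtMost1 x y vx vy x∉AC x∉BD y∉AC y∉BD =
        [ (λ x<y → ⊥-elim (⊕-no-gap x<y x∉AC y∉BD))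
        , [ (λ x≈y → ≋⇒≈Q (cmp≡eq⇒≋ x≈y)) , (λ y<x → ⊥-elim (⊕-no-gap y<x y∉AC x∉BD)) ] ]
        (<⊎≈⊎> (x , vx) (y , vy))

      -- Around p = a + k with radius r = 2 (q - p), q = b + e: a ball meeting both
      -- sides, of diameter 2r = 4 (q - p) < 8δ.
      narrow-ball : ∀ {a b k e d} → a ∈ A → b ∈ B → k ∈ C → e ∈ D →
                    b - a < half (half (half d)) → e - k < half (half (half d)) →
                    Σ ℚα λ x → Σ ℚα λ r → 0ℚ < r × Meets (Ball (proj₁ x) (proj₁ r)) (A ⊕ C)
                                        × Meets (Ball (proj₁ x) (proj₁ r)) (B ⊕ D) × r + r < d
      narrow-ball {a} {b} {k} {e} {d} a∈A b∈B k∈C e∈D b-a<δ e-k<δ = p , r , 0<r , meets-AC , meets-BD , r+r<d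
        where
          p q w r : ℚα
          p = a + k
          q = b + e
          w = q - p
          r = w + w
          p<q : p < q
          p<q = +-mono-< (AB.A<B {a} {b} a∈A b∈B) (CD.A<B {k} {e} k∈C e∈D)
          0<w : 0ℚ < w
          0<w = 0<-diff p<q
          w<r : w < r
          w<r = self<+ w 0<w
          0<r : 0ℚ < r
          0<r = <-trans 0<w w<r
          q<p+r : q < p + r
          q<p+r = trans (cmp-≋ˡ (p + r) (≋-sym (+-sub-cancel p q))) (trans (cmp-+ˡ w r p) w<r)
          meets-AC : Meets (Ball (proj₁ p) (proj₁ r)) (A ⊕ C)
          meets-AC = proj₁ p , center∈ball p 0<r , ∈⊕ {x = a} {k} p a∈A k∈C ≋-refl
          meets-BD : Meets (Ball (proj₁ p) (proj₁ r)) (B ⊕ D)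
          meets-BD = proj₁ q , ⇒ball p r q (<-trans (sub<self p 0<r) p<q) q<p+r , ∈⊕ {x = b} {e} q b∈B e∈D ≋-refl
          w<d/4 : w < half (half d)
          w<d/4 = trans (cmp-≋ˡ (half (half d)) (+-sub-+ a b k e)) (+-<-half b-a<δ e-k<δ)
          r<d/2 : r < half d
          r<d/2 = +-<-half w<d/4 w<d/4
          r+r<d : r + r < d
          r+r<d = +-<-half r<d/2 r<d/2

      ⊕-proper : Proper (A ⊕ C) (B ⊕ D)
      ⊕-proper (d , pos , wide) =
        AB.proper⇒close properAB δ 0<δ λ { (a , b , a∈A , b∈B , b-a<δ) →
        CD.proper⇒close properCD δ 0<δ λ { (k , e , k∈C , e∈D , e-k<δ) →
          wide-contradiction (narrow-ball {a} {b} {k} {e} {d′} a∈A b∈B k∈C e∈D b-a<δ e-k<δ) } }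
        where
          d′ : ℚα
          d′ = (d , proj₁ pos)
          δ = half (half (half d′))
          0<δ = 0<half (0<half (0<half (Positive⇒0< {d′} pos)))
          wide-contradiction : (Σ ℚα λ x → Σ ℚα λ r → 0ℚ < r × Meets (Ball (proj₁ x) (proj₁ r)) (A ⊕ C)
                                 × Meets (Ball (proj₁ x) (proj₁ r)) (B ⊕ D) × r + r < d′) → ⊥
          wide-contradiction (x , r , 0<r , meets-AC , meets-BD , r+r<d) =
            <-irrefl (<-trans (ball-diam>⇒< x r 0<r d′
                                (wide (proj₁ x) (proj₁ r) (proj₂ x) (proj₂ r , <⇒<Q {0ℚ} {r} 0<r) meets-AC meets-BD))
                              r+r<d)

    ⊕-isCut : Proper A B → Proper C D → IsCut (A ⊕ C) (B ⊕ D)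
    ⊕-isCut properAB properCD = record
      { subA = ⊕-isSubset A C
      ; subB = ⊕-isSubset B D
      ; A<B = ⊕-<
      ; gapAtMost1 = ⊕-gapAtMost1 properAB properCD
      ; infB∉B = ⊕-inf∉
      ; supA∉A = ⊕-sup∉
      ; disjoint = ⊕-disjoint
      }

mainTheorem7 : (α : Ordinal) → let open Ops α in
    (A B C D : SubQ) → IsCut A B → IsCut C D → Proper A B → Proper C D
    → IsCut (A ⊕ C) (B ⊕ D) × Proper (A ⊕ C) (B ⊕ D)
mainTheorem7 α A B C D cutAB cutCD properAB properCD =
  ⊕-isCut properAB properCD , ⊕-proper properAB properCD
  where open CutSum.SumOfCuts α cutAB cutCD
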